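{- Let $f$ be any honest function. There exists an elementary function $\check{T}:\mathbb{Q}\to\mathbb{Q}$ such that (i) $\check{T}(q)=0$ if $q<\alpha^f$, and (ii) $q>\check{T}(q)>\alpha^f$ if $q>\alpha^f$.
   Context: A function is elementary if it can be generated from $2^x$, $\max$, $0$, successor and projections by composition and bounded primitive recursion; a relation is elementary if its characteristic function is. Rationals are coded into $\mathbb{N}$ in a standard elementary way. A function $f:\mathbb{N}\to\mathbb{N}$ is honest if $f(x)\le f(x+1)$, $f(x)\ge 2^x$ for all $x$, and the relation $f(x)=y$ is elementary. Let $P_i$ be the $i$-th prime ($P_0=2$). Define $g(0)=1$, $g(j+1)=P_j^{2(j+2)(g(j)+1)^3}$, $h(i)=g(f(i)+i)$, $\alpha^f_n=\sum_{i=0}^nP_i^{ -h(i)}$ and $\alpha^f=\lim_{n\to\infty}\alpha^f_n$ (an irrational number). -}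

module Defs where

open import Data.Nat as ℕ using (ℕ; zero; suc; _+_; _*_; _^_; _≤_; _<_; _⊔_; _!; NonZero)
open import Data.Nat.Properties using (≤-refl; ≤-trans; n≤1+n; m^n≢0)
open import Data.Nat.Primality using (prime?)
open import Data.Nat.Base using (>-nonZero; _/_)
open import Data.Fin using (Fin)
open import Data.Vec using (Vec; []; _∷_; lookup)
open import Data.Integer as ℤ using (ℤ; +_; -[1+_])
open import Data.Rational as ℚ using (ℚ; 0ℚ)
open import Data.Product using (Σ; _×_; ∃)
open import Relation.Nullary using (yes; no)
open import Relation.Binary.PropositionalEquality using (_≡_)

-- Elementary functions (Kalmar): generated from 2^x, max, 0, successor
-- and projections by composition and bounded primitive recursion.
-- A k-ary function is a map Vec ℕ k → ℕ.

data Elem : (k : ℕ) → (Vec ℕ k → ℕ) → Set where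
  exp2  : Elem 1 (λ v → 2 ^ lookup v Fin.zero)
  max   : Elem 2 (λ v → lookup v Fin.zero ⊔ lookup v (Fin.suc Fin.zero))
  zer   : Elem 0 (λ _ → 0)
  succ  : Elem 1 (λ v → suc (lookup v Fin.zero))
  proj  : ∀ {k} (i : Fin k) → Elem k (λ v → lookup v i)
  comp  : ∀ {k m} {f : Vec ℕ m → ℕ} (gs : Fin m → (Vec ℕ k → ℕ)) →
          Elem m f → (∀ i → Elem k (gs i)) →
          Elem k (λ v → f (Data.Vec.tabulate (λ i → gs i v)))
  brec  : ∀ {k} {G : Vec ℕ k → ℕ} {H : Vec ℕ (suc (suc k)) → ℕ}
          {J : Vec ℕ (suc k) → ℕ} (F : Vec ℕ (suc k) → ℕ) →
          Elem k G → Elem (suc (suc k)) H → Elem (suc k) J →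
          (∀ xs → F (0 ∷ xs) ≡ G xs) →
          (∀ y xs → F (suc y ∷ xs) ≡ H (y ∷ F (y ∷ xs) ∷ xs)) →
          (∀ v → F v ≤ J v) →
          Elem (suc k) F
  -- the class is a class of (extensional) functions
  ext   : ∀ {k} {F G : Vec ℕ k → ℕ} → Elem k F → (∀ v → F v ≡ G v) → Elem k G

ElemFun : (ℕ → ℕ) → Set
ElemFun F = Elem 1 (λ v → F (lookup v Fin.zero))

graphχ : (ℕ → ℕ) → ℕ → ℕ → ℕ
graphχ f x y with f x ℕ.≟ y
... | yes _ = 1
... | no _ = 0

Honest : (ℕ → ℕ) → Set
Honest f = (∀ x → f x ≤ f (suc x))
         × (∀ x → 2 ^ x ≤ f x)
         × Elem 2 (λ v → graphχ f (lookup v Fin.zero) (lookup v (Fin.suc Fin.zero)))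

cantor : ℕ → ℕ → ℕ
cantor x y = ((x + y) * suc (x + y)) / 2 + y

zcode : ℤ → ℕ
zcode (+ n) = 2 * n
zcode -[1+ n ] = suc (2 * n)

encℚ : ℚ → ℕ
encℚ q = cantor (zcode (ℚ.numerator q)) (ℚ.denominator-1 q)

ElemℚFun : (ℚ → ℚ) → Set
ElemℚFun T = Σ (ℕ → ℕ) λ F → ElemFun F × (∀ q → F (encℚ q) ≡ encℚ (T q))

-- Primes: P 0 = 2, P (i+1) = least prime > P i (searched in (p, p! + p + 1]).

search : ℕ → ℕ → ℕ
search zero s = s
search (suc k) s with prime? s
... | yes _ = s
... | no _ = search k (suc s)

search-≥ : ∀ k s → s ≤ search k s
search-≥ zero s = ≤-refl
search-≥ (suc k) s with prime? s
... | yes _ = ≤-refl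
... | no _ = ≤-trans (n≤1+n s) (search-≥ k (suc s))

P : ℕ → ℕ
P zero = 2
P (suc i) = search (P i !) (suc (P i))

P-pos : ∀ i → 0 < P i
P-pos zero = ℕ.s≤s ℕ.z≤n
P-pos (suc i) = ≤-trans (ℕ.s≤s ℕ.z≤n) (search-≥ (P i !) (suc (P i)))

P^n-nonZero : ∀ i n → NonZero (P i ^ n)
P^n-nonZero i n = m^n≢0 (P i) n {{>-nonZero (P-pos i)}}

g : ℕ → ℕ
g zero = 1
g (suc j) = P j ^ (2 * (j + 2) * (g j + 1) ^ 3)

h : (ℕ → ℕ) → ℕ → ℕ
h f i = g (f i + i)

term : (ℕ → ℕ) → ℕ → ℚ
term f i = ((+ 1) ℚ./ (P i ^ h f i)) {{P^n-nonZero i (h f i)}}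

αₙ : (ℕ → ℕ) → ℕ → ℚ
αₙ f zero = term f 0
αₙ f (suc n) = αₙ f n ℚ.+ term f (suc n)

-- α^f = lim α^f_n = sup α^f_n (increasing sequence).
-- q < α^f  iff  q < α^f_n for some n
_<α[_] : ℚ → (ℕ → ℕ) → Set
q <α[ f ] = ∃ λ n → q ℚ.< αₙ f n

-- α^f < q  iff  some rational r < q bounds all α^f_n
α[_]<_ : (ℕ → ℕ) → ℚ → Set
α[ f ]< q = ∃ λ r → r ℚ.< q × (∀ n → αₙ f n ℚ.≤ r)

module Submission where

-- Write b for the denominator of q = N/b and E i = P i ^ h f i, so that α^f = Σ 1/E i.  The partial
-- sums A n / D n with D n = E 0 ⋯ E (n-1) are exact fractions, and the tail after them is at most
-- 2/E n since E (i+1) ≥ 2 E i.  Because g grows so fast, some n ≤ b + 1 satisfies 8b · D n ≤ E n,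
-- and the first such n is found by a search of bounded length.  For this n the tail is below
-- 1/(4b D n), which is less than the distance 1/(b D n) between distinct fractions with denominators
-- b and D n.  So q ≤ A n / D n forces q < α^f, while otherwise q > A n / D n + 1/(4b D n) ≥ α^f and
-- a dyadic fraction with odd numerator and denominator 2^(4b D n) fits in between.  Every quantity
-- involved is computed with all intermediate values truncated at an explicit bound, which keeps the
-- whole computation inside bounded recursion; the truncation is harmless because P, g, f and the
-- powers involved are monotone.

open import Defs

module _ where
  open import Data.Nat
    using (ℕ; zero; suc; _+_; _*_; _∸_; _^_; _≤_; _≰_; _<_; _⊔_; _⊓_; z≤n; s≤s; _≤?_; _≟_; _!;
           NonZero; >-nonZero; nonTrivial⇒n>1; n>1⇒nonTrivial)
  open import Data.Nat.Properties
  open import Data.Nat.DivMod using (m*n/n≡m; _%_; [m+kn]%n≡m%n; m*n%n≡0)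
  open import Data.Nat.Divisibility using (_∣_; divides; _∣?_; ∣1⇒≡1; ∣-trans; ∣⇒≤; 0∣⇒≡0)
  open import Data.Nat.Divisibility.Core using (hasNonTrivialDivisor)
  open import Data.Nat.Coprimality using (Coprime; coprime-divisor)
  open import Data.Nat.Primality using (Prime; prime; composite?; prime?; prime⇒nonTrivial)
  open import Data.Nat.Tactic.RingSolver using (solve-∀)
  import Data.Integer as ℤ
  import Data.Integer.Properties as ℤP
  open import Data.Rational as ℚ using (ℚ; mkℚ; 0ℚ)
  import Data.Rational.Properties as ℚP
  open import Data.Rational.Unnormalised as U using (ℚᵘ; mkℚᵘ; _≃_; *≤*; *<*)
  import Data.Rational.Unnormalised.Properties as UP
  open import Data.Vec using (Vec; []; _∷_; lookup; tabulate)
  open import Data.Vec.Properties using (tabulate∘lookup)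
  open import Data.Fin using (Fin; zero; suc)
  open import Data.Empty using (⊥-elim)
  open import Data.Sum using (_⊎_; inj₁; inj₂)
  open import Data.Product using (Σ; _×_; _,_; proj₁; proj₂)
  open import Relation.Nullary using (¬_; Dec; yes; no)
  open import Relation.Binary.PropositionalEquality
  open import Relation.Binary.Definitions using (tri<; tri≈; tri>)

  n<2^n : ∀ n → n < 2 ^ n
  n<2^n zero = s≤s z≤n
  n<2^n (suc n) = begin-strict
    suc n          ≤⟨ n<2^n n ⟩
    2 ^ n          <⟨ m<m+n (2 ^ n) (m^n>0 2 n) ⟩
    2 ^ n + 2 ^ n  ≡⟨ cong ((2 ^ n) +_) (sym (+-identityʳ (2 ^ n))) ⟩
    2 ^ suc n      ∎
    where open ≤-Reasoning

  m∸[m∸n]≡m⊓n : ∀ m n → m ∸ (m ∸ n) ≡ m ⊓ n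
  m∸[m∸n]≡m⊓n m n with ≤-total m n
  ... | inj₁ m≤n = trans (cong (m ∸_) (m≤n⇒m∸n≡0 m≤n)) (sym (m≤n⇒m⊓n≡m m≤n))
  ... | inj₂ n≤m = trans (m∸[m∸n]≡n n≤m) (sym (m≥n⇒m⊓n≡n n≤m))

  m<n⇒n∸m≡1+[n∸1+m] : ∀ {m n} → m < n → n ∸ m ≡ suc (n ∸ suc m)
  m<n⇒n∸m≡1+[n∸1+m] {zero} {suc n} _ = refl
  m<n⇒n∸m≡1+[n∸1+m] {suc m} {suc n} (s≤s m<n) = m<n⇒n∸m≡1+[n∸1+m] m<n

  m≤m^[1+n] : ∀ m n → m ≤ m ^ suc n
  m≤m^[1+n] zero n = z≤n
  m≤m^[1+n] (suc m) n = m≤m*n (suc m) (suc m ^ n) {{>-nonZero (m^n>0 (suc m) n)}}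

  ^-mono-≤ : ∀ {x y a b} → 1 ≤ x → x ≤ y → a ≤ b → x ^ a ≤ y ^ b
  ^-mono-≤ {suc x} {y} {a} {b} _ x≤y a≤b = ≤-trans (^-monoˡ-≤ a x≤y) (^-monoʳ-≤ y {{nz}} a≤b)
    where nz : NonZero y
          nz = >-nonZero (≤-trans (s≤s z≤n) x≤y)

  ≤-step-mono : (F : ℕ → ℕ) → (∀ x → F x ≤ F (suc x)) → ∀ {i j} → i ≤ j → F i ≤ F j
  ≤-step-mono F step {j = zero} z≤n = ≤-refl
  ≤-step-mono F step {i} {suc j} i≤1+j with m≤n⇒m<n∨m≡n i≤1+j
  ... | inj₂ refl = ≤-refl
  ... | inj₁ i<1+j = ≤-trans (≤-step-mono F step (≤-pred i<1+j)) (step j)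

  compose₁ : ∀ {k} {f : Vec ℕ 1 → ℕ} {a : Vec ℕ k → ℕ} →
             Elem 1 f → Elem k a → Elem k (λ v → f (a v ∷ []))
  compose₁ {a = a} ef ea = comp (λ _ → a) ef (λ _ → ea)

  compose₂ : ∀ {k} {f : Vec ℕ 2 → ℕ} {a b : Vec ℕ k → ℕ} →
             Elem 2 f → Elem k a → Elem k b → Elem k (λ v → f (a v ∷ b v ∷ []))
  compose₂ {k} {f} {a} {b} ef ea eb = comp args ef elem-args
    where
    args : Fin 2 → Vec ℕ k → ℕ
    args zero = a
    args (suc _) = b
    elem-args : ∀ i → Elem k (args i)
    elem-args zero = ea
    elem-args (suc zero) = eb

  elem-const : ∀ {k} n → Elem k (λ _ → n)
  elem-const zero = comp (λ ()) zer (λ ())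
  elem-const (suc n) = compose₁ succ (elem-const n)

  arg₀ : ∀ {k} → Vec ℕ (suc k) → ℕ
  arg₀ v = lookup v zero

  arg₁ : ∀ {k} → Vec ℕ (suc (suc k)) → ℕ
  arg₁ v = lookup v (suc zero)

  elem-+ : Elem 2 (λ v → arg₀ v + arg₁ v)
  elem-+ = brec (λ v → arg₀ v + arg₁ v) (proj zero) (compose₁ succ (proj (suc zero)))
             (compose₁ exp2 (compose₁ succ max)) (λ _ → refl) (λ _ _ → refl)
             (λ { (y ∷ x ∷ []) → bound y x })
    where
    bound : ∀ y x → y + x ≤ 2 ^ suc (y ⊔ x)
    bound y x = begin
      y + x                     ≤⟨ +-mono-≤ (m≤m⊔n y x) (m≤n⊔m y x) ⟩
      (y ⊔ x) + (y ⊔ x)         ≤⟨ +-mono-≤ (<⇒≤ (n<2^n (y ⊔ x))) (<⇒≤ (n<2^n (y ⊔ x))) ⟩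
      2 ^ (y ⊔ x) + 2 ^ (y ⊔ x) ≡⟨ cong (2 ^ (y ⊔ x) +_) (sym (+-identityʳ _)) ⟩
      2 ^ suc (y ⊔ x)           ∎
      where open ≤-Reasoning

  elem-* : Elem 2 (λ v → arg₀ v * arg₁ v)
  elem-* = brec (λ v → arg₀ v * arg₁ v) (elem-const 0)
             (compose₂ elem-+ (proj (suc (suc zero))) (proj (suc zero)))
             (compose₁ exp2 elem-+) (λ _ → refl) (λ _ _ → refl)
             (λ { (y ∷ x ∷ []) → bound y x })
    where
    bound : ∀ y x → y * x ≤ 2 ^ (y + x)
    bound y x = ≤-trans (*-mono-≤ (<⇒≤ (n<2^n y)) (<⇒≤ (n<2^n x)))
                        (≤-reflexive (sym (^-distribˡ-+-* 2 y x)))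

  elem-pred : Elem 1 (λ v → arg₀ v ∸ 1)
  elem-pred = brec (λ v → arg₀ v ∸ 1) zer (proj zero) (proj zero) (λ _ → refl)
                (λ { y [] → refl }) (λ { (y ∷ []) → m∸n≤m y 1 })

  elem-∸ : Elem 2 (λ v → arg₀ v ∸ arg₁ v)
  elem-∸ = compose₂ flipped (proj (suc zero)) (proj zero)
    where
    flipped : Elem 2 (λ v → arg₁ v ∸ arg₀ v)
    flipped = brec (λ v → arg₁ v ∸ arg₀ v) (proj zero) (compose₁ elem-pred (proj (suc zero)))
                (proj (suc zero)) (λ _ → refl) (λ { y (x ∷ []) → sym (pred[m∸n]≡m∸[1+n] x y) })
                (λ { (y ∷ x ∷ []) → m∸n≤m x y })

  elem-⊓ : Elem 2 (λ v → arg₀ v ⊓ arg₁ v)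
  elem-⊓ = ext (compose₂ elem-∸ (proj zero) (compose₂ elem-∸ (proj zero) (proj (suc zero))))
               (λ v → m∸[m∸n]≡m⊓n (arg₀ v) (arg₁ v))

  elem-at-0 : ∀ {k} {J : Vec ℕ (suc k) → ℕ} → Elem (suc k) J → Elem k (λ xs → J (0 ∷ xs))
  elem-at-0 {k} {J} eJ = ext (comp args eJ elem-args) (λ xs → cong (λ w → J (0 ∷ w)) (tabulate∘lookup xs))
    where
    args : Fin (suc k) → Vec ℕ k → ℕ
    args zero = λ _ → 0
    args (suc i) = λ xs → lookup xs i
    elem-args : ∀ i → Elem k (args i)
    elem-args zero = elem-const 0
    elem-args (suc i) = proj i

  elem-at-suc : ∀ {k} {J : Vec ℕ (suc k) → ℕ} → Elem (suc k) J →
                Elem (suc (suc k)) (λ v → J (suc (arg₀ v) ∷ Data.Vec.drop 2 v))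
  elem-at-suc {k} {J} eJ =
    ext (comp args eJ elem-args) (λ { (y ∷ _ ∷ xs) → cong (λ w → J (suc y ∷ w)) (tabulate∘lookup xs) })
    where
    args : Fin (suc k) → Vec ℕ (suc (suc k)) → ℕ
    args zero = λ v → suc (arg₀ v)
    args (suc i) = λ v → lookup v (suc (suc i))
    elem-args : ∀ i → Elem (suc (suc k)) (args i)
    elem-args zero = compose₁ succ (proj zero)
    elem-args (suc i) = proj (suc (suc i))

  -- ifZero c a b is a if c = 0 and b otherwise, written arithmetically so that terms can express it.
  opaque
    ifZero : ℕ → ℕ → ℕ → ℕ
    ifZero c a b = a * (1 ∸ c) + b * (1 ∸ (1 ∸ c))

    ifZero-arithmetic : ∀ c a b → ifZero c a b ≡ a * (1 ∸ c) + b * (1 ∸ (1 ∸ c))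
    ifZero-arithmetic c a b = refl

  ifZero-zero : ∀ a b → ifZero 0 a b ≡ a
  ifZero-zero a b rewrite ifZero-arithmetic 0 a b =
    trans (cong₂ _+_ (*-identityʳ a) (*-zeroʳ b)) (+-identityʳ a)

  ifZero-suc : ∀ n a b → ifZero (suc n) a b ≡ b
  ifZero-suc n a b rewrite ifZero-arithmetic (suc n) a b | 0∸n≡0 n =
    cong₂ _+_ (*-zeroʳ a) (*-identityʳ b)

  -- The least t < z with R t ≢ 0, or z if there is none; the step is written the way the
  -- bounded recursion of Terms.firstNonZeroₜ computes it.
  firstNonZero : (ℕ → ℕ) → ℕ → ℕ
  firstNonZero R zero = 0
  firstNonZero R (suc z) =
    ifZero (z ∸ firstNonZero R z) (ifZero (R z) (suc z) z) (firstNonZero R z) ⊓ suc z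

  module _ (R : ℕ → ℕ) where

    firstNonZero-≤ : ∀ z → firstNonZero R z ≤ z
    firstNonZero-≤ zero = z≤n
    firstNonZero-≤ (suc z) = m⊓n≤n _ _

    private
      data Step (z : ℕ) : Set where
        found : firstNonZero R z < z → firstNonZero R (suc z) ≡ firstNonZero R z → Step z
        hit   : firstNonZero R z ≡ z → R z ≡ 0 → firstNonZero R (suc z) ≡ suc z → Step z
        miss  : firstNonZero R z ≡ z → ∀ n → R z ≡ suc n → firstNonZero R (suc z) ≡ z → Step z

      step : ∀ z → Step z
      step z with m≤n⇒m<n∨m≡n (firstNonZero-≤ z)
      ... | inj₁ lt =
        found lt (trans (cong (_⊓ suc z) (trans (cong (λ c → ifZero c (ifZero (R z) (suc z) z) (firstNonZero R z))
                                                       (m<n⇒n∸m≡1+[n∸1+m] lt))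
                                                 (ifZero-suc _ _ _)))
                        (m≤n⇒m⊓n≡m (≤-trans (firstNonZero-≤ z) (n≤1+n z))))
      ... | inj₂ eq with R z in Rz
      ...   | zero = hit eq Rz (trans (cong (_⊓ suc z) eqn) (⊓-idem (suc z)))
        where
        eqn : ifZero (z ∸ firstNonZero R z) (ifZero (R z) (suc z) z) (firstNonZero R z) ≡ suc z
        eqn rewrite eq | n∸n≡0 z | Rz = trans (ifZero-zero _ _) (ifZero-zero _ _)
      ...   | suc n = miss eq n Rz (trans (cong (_⊓ suc z) eqn) (m≤n⇒m⊓n≡m (n≤1+n z)))
        where
        eqn : ifZero (z ∸ firstNonZero R z) (ifZero (R z) (suc z) z) (firstNonZero R z) ≡ z
        eqn rewrite eq | n∸n≡0 z | Rz = trans (ifZero-zero _ _) (ifZero-suc _ _ _)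

    firstNonZero-below : ∀ z t → t < firstNonZero R z → R t ≡ 0
    firstNonZero-below (suc z) t t<μ with step z
    ... | found _ e = firstNonZero-below z t (subst (t <_) e t<μ)
    ... | miss eq _ _ e = firstNonZero-below z t (subst (t <_) (trans e (sym eq)) t<μ)
    ... | hit eq R0 e with m≤n⇒m<n∨m≡n (≤-pred (subst (t <_) e t<μ))
    ...   | inj₁ t<z = firstNonZero-below z t (subst (t <_) (sym eq) t<z)
    ...   | inj₂ refl = R0

    firstNonZero-hit : ∀ z → firstNonZero R z < z → R (firstNonZero R z) ≢ 0
    firstNonZero-hit (suc z) μ<1+z with step z
    ... | found lt e rewrite e = firstNonZero-hit z lt
    ... | miss eq n Rz e rewrite e | eq = λ R0 → 1+n≢0 (trans (sym Rz) R0)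
    ... | hit _ _ e rewrite e = ⊥-elim (<-irrefl refl μ<1+z)

    firstNonZero-none : ∀ z → (∀ t → t < z → R t ≡ 0) → firstNonZero R z ≡ z
    firstNonZero-none z zeros with m≤n⇒m<n∨m≡n (firstNonZero-≤ z)
    ... | inj₂ e = e
    ... | inj₁ lt = ⊥-elim (firstNonZero-hit z lt (zeros _ lt))

    firstNonZero-< : ∀ z t → t < z → R t ≢ 0 → firstNonZero R z < z
    firstNonZero-< z t t<z Rt≢0 with m≤n⇒m<n∨m≡n (firstNonZero-≤ z)
    ... | inj₁ lt = lt
    ... | inj₂ e = ⊥-elim (Rt≢0 (firstNonZero-below z t (subst (t <_) (sym e) t<z)))

    firstNonZero-≡ : ∀ z t → t < z → R t ≢ 0 → (∀ s → s < t → R s ≡ 0) → firstNonZero R z ≡ t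
    firstNonZero-≡ z t t<z Rt≢0 zeros with <-cmp (firstNonZero R z) t
    ... | tri≈ _ e _ = e
    ... | tri> _ _ gt = ⊥-elim (Rt≢0 (firstNonZero-below z t gt))
    ... | tri< lt _ _ = ⊥-elim (firstNonZero-hit z (<-≤-trans lt (<⇒≤ t<z)) (zeros _ lt))

  search-none : ∀ k s → (∀ t → t < k → ¬ Prime (s + t)) → search k s ≡ s + k
  search-none zero s _ = sym (+-identityʳ s)
  search-none (suc k) s composites with prime? s
  ... | yes p = ⊥-elim (composites 0 (s≤s z≤n) (subst Prime (sym (+-identityʳ s)) p))
  ... | no _ = trans (search-none k (suc s) shifted) (sym (+-suc s k))
    where
    shifted : ∀ t → t < k → ¬ Prime (suc s + t)
    shifted t t<k p = composites (suc t) (s≤s t<k) (subst Prime (sym (+-suc s t)) p)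

  search-first : ∀ k s t → t < k → Prime (s + t) → (∀ t′ → t′ < t → ¬ Prime (s + t′)) →
                 search k s ≡ s + t
  search-first (suc k) s t t<k p composites with prime? s | t
  ... | yes _ | zero = sym (+-identityʳ s)
  ... | yes q | suc _ = ⊥-elim (composites 0 (s≤s z≤n) (subst Prime (sym (+-identityʳ s)) q))
  ... | no q | zero = ⊥-elim (q (subst Prime (+-identityʳ s) p))
  ... | no _ | suc t = trans (search-first k (suc s) t (≤-pred t<k) (subst Prime (+-suc s t) p) shifted)
                            (sym (+-suc s t))
    where
    shifted : ∀ t′ → t′ < t → ¬ Prime (suc s + t′)
    shifted t′ t′<t q = composites (suc t′) (s≤s t′<t) (subst Prime (sym (+-suc s t′)) q)

  search-≤ : ∀ k s → search k s ≤ s + k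
  search-≤ zero s = m≤m+n s 0
  search-≤ (suc k) s with prime? s
  ... | yes _ = m≤m+n s (suc k)
  ... | no _ = ≤-trans (search-≤ k (suc s)) (≤-reflexive (sym (+-suc s k)))

  search-found : ∀ k′ k s → k′ ≤ k → search k′ s < s + k′ → search k s ≡ search k′ s
  search-found zero k s _ found = ⊥-elim (<-irrefl (sym (+-identityʳ s)) found)
  search-found (suc k′) (suc k) s (s≤s k′≤k) found with prime? s
  ... | yes _ = refl
  ... | no _ = search-found k′ k (suc s) k′≤k (<-≤-trans found (≤-reflexive (+-suc s k′)))

  search-exhausted : ∀ k′ k s → k′ ≤ k → search k′ s ≡ s + k′ → s + k′ ≤ search k s
  search-exhausted zero k s _ _ = ≤-trans (≤-reflexive (+-identityʳ s)) (search-≥ k s)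
  search-exhausted (suc k′) (suc k) s (s≤s k′≤k) exhausted with prime? s
  ... | yes _ = ⊥-elim (<-irrefl exhausted (m<m+n s (s≤s z≤n)))
  ... | no _ = ≤-trans (≤-reflexive (+-suc s k′))
                       (search-exhausted k′ k (suc s) k′≤k (trans exhausted (+-suc s k′)))

  search[k⊓b]⊓1+b≡search[k]⊓1+b : ∀ k b s → 1 ≤ s → search (k ⊓ b) s ⊓ suc b ≡ search k s ⊓ suc b
  search[k⊓b]⊓1+b≡search[k]⊓1+b k b s 1≤s with m≤n⇒m<n∨m≡n (search-≤ (k ⊓ b) s)
  ... | inj₁ found = cong (_⊓ suc b) (sym (search-found (k ⊓ b) k s (m⊓n≤m k b) found))
  ... | inj₂ exhausted with k ≤? b
  ...   | yes k≤b = cong (λ w → search w s ⊓ suc b) (m≤n⇒m⊓n≡m k≤b)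
  ...   | no k≰b = trans (m≥n⇒m⊓n≡n (≤-trans 1+b≤ (≤-reflexive (sym exhausted))))
                         (sym (m≥n⇒m⊓n≡n (≤-trans 1+b≤ (search-exhausted (k ⊓ b) k s (m⊓n≤m k b) exhausted))))
    where
    1+b≤ : suc b ≤ s + (k ⊓ b)
    1+b≤ = ≤-trans (+-monoˡ-≤ b 1≤s) (≤-reflexive (cong (s +_) (sym (m≥n⇒m⊓n≡n (<⇒≤ (≰⇒> k≰b))))))

  P≥2 : ∀ j → 2 ≤ P j
  P≥2 zero = ≤-refl
  P≥2 (suc j) = ≤-trans (≤-trans (P≥2 j) (n≤1+n (P j))) (search-≥ (P j !) (suc (P j)))

  P-< : ∀ j → P j < P (suc j)
  P-< j = search-≥ (P j !) (suc (P j))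

  P-mono-≤ : ∀ {i j} → i ≤ j → P i ≤ P j
  P-mono-≤ = ≤-step-mono P (λ j → <⇒≤ (P-< j))

  gExponent : ℕ → ℕ
  gExponent j = 2 * (j + 2) * (g j + 1) ^ 3

  g≥1 : ∀ j → 1 ≤ g j
  g≥1 zero = ≤-refl
  g≥1 (suc j) = m^n>0 (P j) {{>-nonZero (≤-trans (s≤s z≤n) (P≥2 j))}} (gExponent j)

  g<gExponent : ∀ j → g j < gExponent j
  g<gExponent j = ≤-trans (≤-reflexive (+-comm 1 (g j)))
                          (≤-trans (m≤m^[1+n] (g j + 1) 2) (m≤n*m ((g j + 1) ^ 3) (2 * (j + 2)) {{nz}}))
    where nz : NonZero (2 * (j + 2))
          nz = subst NonZero (cong (2 *_) (+-comm 2 j)) _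

  g-< : ∀ j → g j < g (suc j)
  g-< j = <-≤-trans (g<gExponent j) (≤-trans (<⇒≤ (n<2^n (gExponent j))) (^-monoˡ-≤ (gExponent j) (P≥2 j)))

  g-mono-< : ∀ {i j} → i < j → g i < g j
  g-mono-< {i} {suc j} (s≤s i≤j) with m≤n⇒m<n∨m≡n i≤j
  ... | inj₁ i<j = <-trans (g-mono-< i<j) (g-< j)
  ... | inj₂ refl = g-< j

  g-mono-≤ : ∀ {i j} → i ≤ j → g i ≤ g j
  g-mono-≤ = ≤-step-mono g (λ j → <⇒≤ (g-< j))

  3+b+g*[1+b]≤gExponent : ∀ {b m} → b ≤ m → 3 + b + g m * suc b ≤ gExponent m
  3+b+g*[1+b]≤gExponent {b} {m} b≤m = begin
    3 + b + g m * suc b              ≡⟨ +-comm (3 + b) (g m * suc b) ⟩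
    g m * suc b + (3 + b)            ≤⟨ +-mono-≤ (*-monoʳ-≤ (g m) (≤-trans (s≤s b≤m) (m≤n+m (suc m) 2)))
                                                 (≤-trans (+-monoʳ-≤ 3 b≤m) (≤-reflexive (sym (*-identityˡ (3 + m))))) ⟩
    g m * (3 + m) + 1 * (3 + m)      ≡⟨ sym (*-distribʳ-+ (3 + m) (g m) 1) ⟩
    (g m + 1) * (3 + m)              ≤⟨ *-mono-≤ (m≤m^[1+n] (g m + 1) 2) (m≤m+n (3 + m) (m + 1)) ⟩
    (g m + 1) ^ 3 * (3 + m + (m + 1)) ≡⟨ cong ((g m + 1) ^ 3 *_) (expand m) ⟩
    (g m + 1) ^ 3 * (2 * (m + 2))    ≡⟨ *-comm ((g m + 1) ^ 3) (2 * (m + 2)) ⟩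
    gExponent m                      ∎
    where
    open ≤-Reasoning
    expand : ∀ m → 3 + m + (m + 1) ≡ 2 * (m + 2)
    expand = solve-∀

  n<g : ∀ j → j < g j
  n<g zero = s≤s z≤n
  n<g (suc j) = ≤-trans (s≤s (n<g j)) (g-< j)

  [x*[a⊓c]]⊓c≡[x*a]⊓c : ∀ x a c → (x * (a ⊓ c)) ⊓ c ≡ (x * a) ⊓ c
  [x*[a⊓c]]⊓c≡[x*a]⊓c x a c with a ≤? c | x
  ... | yes a≤c | _ rewrite m≤n⇒m⊓n≡m a≤c = refl
  ... | no _ | zero = refl
  ... | no a≰c | suc x rewrite m≥n⇒m⊓n≡n (<⇒≤ (≰⇒> a≰c)) =
    trans (m≥n⇒m⊓n≡n (m≤n*m c (suc x)))
          (sym (m≥n⇒m⊓n≡n (≤-trans (<⇒≤ (≰⇒> a≰c)) (m≤n*m a (suc x)))))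

  [x⊓c]^e⊓c≡x^e⊓c : ∀ x e c → 1 ≤ e → (x ⊓ c) ^ e ⊓ c ≡ x ^ e ⊓ c
  [x⊓c]^e⊓c≡x^e⊓c x (suc e) c _ with x ≤? c
  ... | yes x≤c rewrite m≤n⇒m⊓n≡m x≤c = refl
  ... | no x≰c rewrite m≥n⇒m⊓n≡n (<⇒≤ (≰⇒> x≰c)) =
    trans (m≥n⇒m⊓n≡n (m≤m^[1+n] c e)) (sym (m≥n⇒m⊓n≡n (≤-trans (<⇒≤ (≰⇒> x≰c)) (m≤m^[1+n] x e))))

  x^[e⊓c]⊓c≡x^e⊓c : ∀ x e c → 2 ≤ x → x ^ (e ⊓ c) ⊓ c ≡ x ^ e ⊓ c
  x^[e⊓c]⊓c≡x^e⊓c x e c 2≤x with e ≤? c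
  ... | yes e≤c rewrite m≤n⇒m⊓n≡m e≤c = refl
  ... | no e≰c rewrite m≥n⇒m⊓n≡n (<⇒≤ (≰⇒> e≰c)) =
    trans (m≥n⇒m⊓n≡n (≤-trans (<⇒≤ (n<2^n c)) (^-monoˡ-≤ c 2≤x)))
          (sym (m≥n⇒m⊓n≡n (≤-trans (<⇒≤ (≰⇒> e≰c)) (≤-trans (<⇒≤ (n<2^n e)) (^-monoˡ-≤ e 2≤x)))))

  g[m⊓c+i]⊓c≡g[m+i]⊓c : ∀ m i c → g (m ⊓ c + i) ⊓ c ≡ g (m + i) ⊓ c
  g[m⊓c+i]⊓c≡g[m+i]⊓c m i c with m ≤? c
  ... | yes m≤c rewrite m≤n⇒m⊓n≡m m≤c = refl
  ... | no m≰c rewrite m≥n⇒m⊓n≡n (<⇒≤ (≰⇒> m≰c)) =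
    trans (m≥n⇒m⊓n≡n (≤-trans (m≤m+n c i) (<⇒≤ (n<g (c + i)))))
          (sym (m≥n⇒m⊓n≡n (≤-trans (<⇒≤ (≰⇒> m≰c)) (≤-trans (m≤m+n m i) (<⇒≤ (n<g (m + i)))))))

  graphχ-≡ : ∀ f x → graphχ f x (f x) ≡ 1
  graphχ-≡ f x with f x ≟ f x
  ... | yes _ = refl
  ... | no ne = ⊥-elim (ne refl)

  graphχ-≢ : ∀ f x y → f x ≢ y → graphχ f x y ≡ 0
  graphχ-≢ f x y ne with f x ≟ y
  ... | yes e = ⊥-elim (ne e)
  ... | no _ = refl

  quotient<1+n : ∀ d n → d ∣ n → Σ ℕ λ t → t * d ≡ n × t < suc n
  quotient<1+n zero n (divides q n≡q*0) = 0 , trans (sym (*-zeroʳ q)) (sym n≡q*0) , s≤s z≤n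
  quotient<1+n (suc d) n (divides q n≡q*d) =
    q , sym n≡q*d , s≤s (subst (q ≤_) (sym n≡q*d) (m≤m*n q (suc d)))

  triangle : ℕ → ℕ
  triangle zero = 0
  triangle (suc s) = triangle s + suc s

  triangle*2≡n*[1+n] : ∀ s → triangle s * 2 ≡ s * suc s
  triangle*2≡n*[1+n] zero = refl
  triangle*2≡n*[1+n] (suc s) = begin
    (triangle s + suc s) * 2     ≡⟨ *-distribʳ-+ 2 (triangle s) (suc s) ⟩
    triangle s * 2 + suc s * 2   ≡⟨ cong (_+ suc s * 2) (triangle*2≡n*[1+n] s) ⟩
    s * suc s + suc s * 2        ≡⟨ expand s ⟩
    suc s * suc (suc s)          ∎
    where
    open ≡-Reasoning
    expand : ∀ s → s * suc s + suc s * 2 ≡ suc s * suc (suc s)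
    expand = solve-∀

  cantor≡triangle+y : ∀ x y → cantor x y ≡ triangle (x + y) + y
  cantor≡triangle+y x y =
    cong (_+ y) (trans (cong (Data.Nat._/ 2) (sym (triangle*2≡n*[1+n] (x + y)))) (m*n/n≡m (triangle (x + y)) 2))

  triangle≤n*n : ∀ s → triangle s ≤ s * s
  triangle≤n*n zero = z≤n
  triangle≤n*n (suc s) = begin
    triangle s + suc s  ≤⟨ +-monoˡ-≤ (suc s) (triangle≤n*n s) ⟩
    s * s + suc s       ≤⟨ +-monoˡ-≤ (suc s) (*-monoʳ-≤ s (n≤1+n s)) ⟩
    s * suc s + suc s   ≡⟨ +-comm (s * suc s) (suc s) ⟩
    suc s * suc s       ∎
    where open ≤-Reasoning

  n≤triangle : ∀ s → s ≤ triangle s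
  n≤triangle zero = z≤n
  n≤triangle (suc s) = m≤n+m (suc s) (triangle s)

  triangle-mono-≤ : ∀ {s t} → s ≤ t → triangle s ≤ triangle t
  triangle-mono-≤ {t = zero} z≤n = z≤n
  triangle-mono-≤ {zero} {suc t} _ = z≤n
  triangle-mono-≤ {suc s} {suc t} (s≤s s≤t) = +-mono-≤ (triangle-mono-≤ s≤t) (s≤s s≤t)

  -- Terms built from the elementary operations, a given elementary binary function gχ and
  -- functions already known to be elementary (prim); rec is bounded recursion whose values are
  -- truncated at the bound J.
  module Terms (gχ : ℕ → ℕ → ℕ) (elem-gχ : Elem 2 (λ v → gχ (arg₀ v) (arg₁ v))) where

    infixl 6 _⊕_ _⊖_
    infixl 7 _⊗_
    data Term : ℕ → Set where
      var : ∀ {k} → Fin k → Term k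
      lit : ∀ {k} → ℕ → Term k
      _⊕_ _⊗_ _⊖_ _⊓ₜ_ : ∀ {k} → Term k → Term k → Term k
      pow2 inc : ∀ {k} → Term k → Term k
      graph : ∀ {k} → Term k → Term k → Term k
      app : ∀ {k m} → Term m → (Fin m → Term k) → Term k
      prim : ∀ {k m} {F : Vec ℕ m → ℕ} → Elem m F → (Fin m → Term k) → Term k
      rec : ∀ {k} → Term k → Term (suc (suc k)) → Term (suc k) → Term (suc k)

    truncRec : ∀ {k} → (Vec ℕ k → ℕ) → (Vec ℕ (suc (suc k)) → ℕ) → (Vec ℕ (suc k) → ℕ) →
               ℕ → Vec ℕ k → ℕ
    truncRec G H J zero xs = G xs ⊓ J (0 ∷ xs)
    truncRec G H J (suc y) xs = H (y ∷ truncRec G H J y xs ∷ xs) ⊓ J (suc y ∷ xs)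

    ⟦_⟧ : ∀ {k} → Term k → Vec ℕ k → ℕ
    ⟦ var i ⟧ v = lookup v i
    ⟦ lit n ⟧ v = n
    ⟦ a ⊕ b ⟧ v = ⟦ a ⟧ v + ⟦ b ⟧ v
    ⟦ a ⊗ b ⟧ v = ⟦ a ⟧ v * ⟦ b ⟧ v
    ⟦ a ⊖ b ⟧ v = ⟦ a ⟧ v ∸ ⟦ b ⟧ v
    ⟦ a ⊓ₜ b ⟧ v = ⟦ a ⟧ v ⊓ ⟦ b ⟧ v
    ⟦ pow2 a ⟧ v = 2 ^ ⟦ a ⟧ v
    ⟦ inc a ⟧ v = suc (⟦ a ⟧ v)
    ⟦ graph a b ⟧ v = gχ (⟦ a ⟧ v) (⟦ b ⟧ v)
    ⟦ app t ts ⟧ v = ⟦ t ⟧ (tabulate (λ i → ⟦ ts i ⟧ v))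
    ⟦ prim {F = F} _ ts ⟧ v = F (tabulate (λ i → ⟦ ts i ⟧ v))
    ⟦ rec G H J ⟧ (y ∷ xs) = truncRec ⟦ G ⟧ ⟦ H ⟧ ⟦ J ⟧ y xs

    elem-⟦⟧ : ∀ {k} (t : Term k) → Elem k ⟦ t ⟧
    elem-⟦⟧ (var i) = proj i
    elem-⟦⟧ (lit n) = elem-const n
    elem-⟦⟧ (a ⊕ b) = compose₂ elem-+ (elem-⟦⟧ a) (elem-⟦⟧ b)
    elem-⟦⟧ (a ⊗ b) = compose₂ elem-* (elem-⟦⟧ a) (elem-⟦⟧ b)
    elem-⟦⟧ (a ⊖ b) = compose₂ elem-∸ (elem-⟦⟧ a) (elem-⟦⟧ b)
    elem-⟦⟧ (a ⊓ₜ b) = compose₂ elem-⊓ (elem-⟦⟧ a) (elem-⟦⟧ b)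
    elem-⟦⟧ (pow2 a) = compose₁ exp2 (elem-⟦⟧ a)
    elem-⟦⟧ (inc a) = compose₁ succ (elem-⟦⟧ a)
    elem-⟦⟧ (graph a b) = compose₂ elem-gχ (elem-⟦⟧ a) (elem-⟦⟧ b)
    elem-⟦⟧ (app t ts) = comp (λ i → ⟦ ts i ⟧) (elem-⟦⟧ t) (λ i → elem-⟦⟧ (ts i))
    elem-⟦⟧ (prim eF ts) = comp (λ i → ⟦ ts i ⟧) eF (λ i → elem-⟦⟧ (ts i))
    elem-⟦⟧ {suc k} (rec G H J) =
      brec ⟦ rec G H J ⟧
        (compose₂ elem-⊓ (elem-⟦⟧ G) (elem-at-0 (elem-⟦⟧ J)))
        (compose₂ elem-⊓ (elem-⟦⟧ H) (elem-at-suc (elem-⟦⟧ J)))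
        (elem-⟦⟧ J)
        (λ _ → refl) (λ _ _ → refl)
        (λ { (zero ∷ xs) → m⊓n≤n _ _ ; (suc y ∷ xs) → m⊓n≤n _ _ })

    x₀ : ∀ {k} → Term (suc k)
    x₀ = var zero
    x₁ : ∀ {k} → Term (suc (suc k))
    x₁ = var (suc zero)
    x₂ : ∀ {k} → Term (suc (suc (suc k)))
    x₂ = var (suc (suc zero))

    call₁ : ∀ {k} → Term 1 → Term k → Term k
    call₁ t a = app t (λ _ → a)

    args₂ : ∀ {k} → Term k → Term k → Fin 2 → Term k
    args₂ a b zero = a
    args₂ a b (suc _) = b

    call₂ : ∀ {k} → Term 2 → Term k → Term k → Term k
    call₂ t a b = app t (args₂ a b)

    args₃ : ∀ {k} → Term k → Term k → Term k → Fin 3 → Term k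
    args₃ a b c zero = a
    args₃ a b c (suc zero) = b
    args₃ a b c (suc (suc _)) = c

    call₃ : ∀ {k} → Term 3 → Term k → Term k → Term k → Term k
    call₃ t a b c = app t (args₃ a b c)

    ifZeroₜ : ∀ {k} → Term k → Term k → Term k → Term k
    ifZeroₜ c a b = a ⊗ (lit 1 ⊖ c) ⊕ b ⊗ (lit 1 ⊖ (lit 1 ⊖ c))

    ⟦ifZero⟧ : ∀ {k} (c a b : Term k) v → ⟦ ifZeroₜ c a b ⟧ v ≡ ifZero (⟦ c ⟧ v) (⟦ a ⟧ v) (⟦ b ⟧ v)
    ⟦ifZero⟧ c a b v = sym (ifZero-arithmetic _ _ _)

    ⟦rec⟧≡ : ∀ {k} (G : Term k) (H : Term (suc (suc k))) (J : Term (suc k)) (xs : Vec ℕ k) (F : ℕ → ℕ) →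
             F 0 ≡ ⟦ G ⟧ xs → (∀ y → F (suc y) ≡ ⟦ H ⟧ (y ∷ F y ∷ xs)) →
             (∀ y → F y ≤ ⟦ J ⟧ (y ∷ xs)) → ∀ y → ⟦ rec G H J ⟧ (y ∷ xs) ≡ F y
    ⟦rec⟧≡ G H J xs F F0 Fsuc bounded zero =
      trans (cong (_⊓ ⟦ J ⟧ (0 ∷ xs)) (sym F0)) (m≤n⇒m⊓n≡m (bounded 0))
    ⟦rec⟧≡ G H J xs F F0 Fsuc bounded (suc y) =
      trans (cong (λ w → ⟦ H ⟧ (y ∷ w ∷ xs) ⊓ ⟦ J ⟧ (suc y ∷ xs)) (⟦rec⟧≡ G H J xs F F0 Fsuc bounded y))
            (trans (cong (_⊓ ⟦ J ⟧ (suc y ∷ xs)) (sym (Fsuc y))) (m≤n⇒m⊓n≡m (bounded (suc y))))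

    firstNonZeroₜ : ∀ {k} → Term (suc k) → Term (suc k)
    firstNonZeroₜ {k} R = rec (lit 0) (ifZeroₜ (x₀ ⊖ x₁) (ifZeroₜ (app R skip₁) (inc x₀) x₀) x₁) x₀
      where
      skip₁ : Fin (suc k) → Term (suc (suc k))
      skip₁ zero = var zero
      skip₁ (suc i) = var (suc (suc i))

    ⟦firstNonZero⟧ : ∀ {k} (R : Term (suc k)) z xs →
                     ⟦ firstNonZeroₜ R ⟧ (z ∷ xs) ≡ firstNonZero (λ t → ⟦ R ⟧ (t ∷ xs)) z
    ⟦firstNonZero⟧ R zero xs = refl
    ⟦firstNonZero⟧ R (suc z) xs
      rewrite ⟦firstNonZero⟧ R z xs | tabulate∘lookup xs
            | ifZero-arithmetic (z ∸ firstNonZero (λ t → ⟦ R ⟧ (t ∷ xs)) z) (ifZero (⟦ R ⟧ (z ∷ xs)) (suc z) z)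
                                (firstNonZero (λ t → ⟦ R ⟧ (t ∷ xs)) z)
            | ifZero-arithmetic (⟦ R ⟧ (z ∷ xs)) (suc z) z = refl

    eqₜ : Term 2
    eqₜ = lit 1 ⊖ ((x₀ ⊖ x₁) ⊕ (x₁ ⊖ x₀))

    eqₜ-refl : ∀ a → ⟦ eqₜ ⟧ (a ∷ a ∷ []) ≡ 1
    eqₜ-refl a rewrite n∸n≡0 a = refl

    eqₜ-≢ : ∀ a b → a ≢ b → ⟦ eqₜ ⟧ (a ∷ b ∷ []) ≡ 0
    eqₜ-≢ a b a≢b with <-cmp a b
    ... | tri< a<b _ _ rewrite m≤n⇒m∸n≡0 (<⇒≤ a<b) | m<n⇒n∸m≡1+[n∸1+m] a<b = 0∸n≡0 (b ∸ suc a)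
    ... | tri≈ _ a≡b _ = ⊥-elim (a≢b a≡b)
    ... | tri> _ _ b<a rewrite m≤n⇒m∸n≡0 (<⇒≤ b<a) | m<n⇒n∸m≡1+[n∸1+m] b<a | +-identityʳ (a ∸ suc b) =
      0∸n≡0 (a ∸ suc b)

    leₜ : Term 2
    leₜ = lit 1 ⊖ (x₀ ⊖ x₁)

    leₜ-≤ : ∀ a b → a ≤ b → ⟦ leₜ ⟧ (a ∷ b ∷ []) ≡ 1
    leₜ-≤ a b a≤b rewrite m≤n⇒m∸n≡0 a≤b = refl

    leₜ-> : ∀ a b → b < a → ⟦ leₜ ⟧ (a ∷ b ∷ []) ≡ 0
    leₜ-> a b b<a rewrite m<n⇒n∸m≡1+[n∸1+m] b<a = 0∸n≡0 (a ∸ suc b)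

    dividesₜ : Term 2
    dividesₜ = inc x₁ ⊖ app (firstNonZeroₜ (call₂ eqₜ (x₀ ⊗ x₁) x₂)) (args₃ (inc x₁) x₀ x₁)

    ⟦divides⟧ : ∀ d n → ⟦ dividesₜ ⟧ (d ∷ n ∷ []) ≡
                suc n ∸ firstNonZero (λ t → ⟦ eqₜ ⟧ (t * d ∷ n ∷ [])) (suc n)
    ⟦divides⟧ d n = cong (suc n ∸_) (⟦firstNonZero⟧ (call₂ eqₜ (x₀ ⊗ x₁) x₂) (suc n) (d ∷ n ∷ []))

    dividesₜ-∤ : ∀ d n → ¬ d ∣ n → ⟦ dividesₜ ⟧ (d ∷ n ∷ []) ≡ 0
    dividesₜ-∤ d n d∤n = trans (⟦divides⟧ d n)
      (trans (cong (suc n ∸_) (firstNonZero-none _ (suc n) (λ t _ → eqₜ-≢ (t * d) n (λ e → d∤n (divides t (sym e))))))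
             (n∸n≡0 (suc n)))

    dividesₜ-∣ : ∀ d n → d ∣ n → ⟦ dividesₜ ⟧ (d ∷ n ∷ []) ≢ 0
    dividesₜ-∣ d n d∣n ≡0 with quotient<1+n d n d∣n
    ... | t , t*d≡n , t<1+n = <-irrefl refl (<-≤-trans μ<1+n (m∸n≡0⇒m≤n (trans (sym (⟦divides⟧ d n)) ≡0)))
      where
      R : ℕ → ℕ
      R t = ⟦ eqₜ ⟧ (t * d ∷ n ∷ [])
      Rt≡1 : R t ≡ 1
      Rt≡1 rewrite t*d≡n = eqₜ-refl n
      μ<1+n : firstNonZero R (suc n) < suc n
      μ<1+n = firstNonZero-< R (suc n) t t<1+n (λ R0 → 1+n≢0 (trans (sym Rt≡1) R0))

    hasDivisorₜ : Term 2
    hasDivisorₜ = call₂ leₜ (lit 2) x₀ ⊗ call₂ dividesₜ x₀ x₁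

    hasDivisorₜ-∣ : ∀ d n → 2 ≤ d → d ∣ n → ⟦ hasDivisorₜ ⟧ (d ∷ n ∷ []) ≢ 0
    hasDivisorₜ-∣ d n 2≤d d∣n rewrite leₜ-≤ 2 d 2≤d | +-identityʳ (⟦ dividesₜ ⟧ (d ∷ n ∷ [])) =
      dividesₜ-∣ d n d∣n

    hasDivisorₜ-∤ : ∀ d n → ¬ (2 ≤ d × d ∣ n) → ⟦ hasDivisorₜ ⟧ (d ∷ n ∷ []) ≡ 0
    hasDivisorₜ-∤ d n ¬divisor with 2 ≤? d
    ... | no 2≰d rewrite leₜ-> 2 d (≰⇒> 2≰d) = refl
    ... | yes 2≤d with d ∣? n
    ...   | yes d∣n = ⊥-elim (¬divisor (2≤d , d∣n))
    ...   | no d∤n rewrite leₜ-≤ 2 d 2≤d | dividesₜ-∤ d n d∤n = refl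

    primeₜ : Term 1
    primeₜ = call₂ leₜ (lit 2) x₀ ⊗ call₂ eqₜ (app (firstNonZeroₜ hasDivisorₜ) (args₂ x₀ x₀)) x₀

    ⟦prime⟧ : ∀ n → ⟦ primeₜ ⟧ (n ∷ []) ≡
              ⟦ leₜ ⟧ (2 ∷ n ∷ []) * ⟦ eqₜ ⟧ (firstNonZero (λ d → ⟦ hasDivisorₜ ⟧ (d ∷ n ∷ [])) n ∷ n ∷ [])
    ⟦prime⟧ n = cong (λ w → ⟦ leₜ ⟧ (2 ∷ n ∷ []) * ⟦ eqₜ ⟧ (w ∷ n ∷ []))
                     (⟦firstNonZero⟧ hasDivisorₜ n (n ∷ []))

    primeₜ-prime : ∀ n → Prime n → ⟦ primeₜ ⟧ (n ∷ []) ≡ 1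
    primeₜ-prime n p = begin
      ⟦ primeₜ ⟧ (n ∷ [])                                  ≡⟨ ⟦prime⟧ n ⟩
      ⟦ leₜ ⟧ (2 ∷ n ∷ []) * ⟦ eqₜ ⟧ (_ ∷ n ∷ [])          ≡⟨ cong₂ (λ a w → a * ⟦ eqₜ ⟧ (w ∷ n ∷ []))
                                                               (leₜ-≤ 2 n (nonTrivial⇒n>1 n {{prime⇒nonTrivial p}}))
                                                               (firstNonZero-none _ n noDivisor) ⟩
      1 * ⟦ eqₜ ⟧ (n ∷ n ∷ [])                             ≡⟨ cong (1 *_) (eqₜ-refl n) ⟩
      1                                                    ∎
      where
      open ≡-Reasoning
      noDivisor : ∀ d → d < n → ⟦ hasDivisorₜ ⟧ (d ∷ n ∷ []) ≡ 0
      noDivisor d d<n = hasDivisorₜ-∤ d n λ { (2≤d , d∣n) →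
        Prime.notComposite p (hasNonTrivialDivisor {divisor = d} {{n>1⇒nonTrivial 2≤d}} d<n d∣n) }

    primeₜ-¬prime : ∀ n → ¬ Prime n → ⟦ primeₜ ⟧ (n ∷ []) ≡ 0
    primeₜ-¬prime n ¬p with 2 ≤? n
    ... | no 2≰n rewrite ⟦prime⟧ n | leₜ-> 2 n (≰⇒> 2≰n) = refl
    ... | yes 2≤n with composite? n
    ...   | no ¬c = ⊥-elim (¬p (prime {{n>1⇒nonTrivial 2≤n}} ¬c))
    ...   | yes (hasNonTrivialDivisor {d} {{nt}} d<n d∣n) =
      trans (⟦prime⟧ n) (trans (cong (⟦ leₜ ⟧ (2 ∷ n ∷ []) *_) (eqₜ-≢ _ n (λ e → <-irrefl e μ<n)))
                               (*-zeroʳ (⟦ leₜ ⟧ (2 ∷ n ∷ []))))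
      where
      μ<n : firstNonZero (λ d → ⟦ hasDivisorₜ ⟧ (d ∷ n ∷ [])) n < n
      μ<n = firstNonZero-< _ n d d<n (hasDivisorₜ-∣ d n (nonTrivial⇒n>1 d {{nt}}) d∣n)

    searchₜ : Term 2
    searchₜ = x₁ ⊕ app (firstNonZeroₜ (call₁ primeₜ (x₁ ⊕ x₀))) (args₂ x₀ x₁)

    ⟦search⟧ : ∀ k s → ⟦ searchₜ ⟧ (k ∷ s ∷ []) ≡ search k s
    ⟦search⟧ k s rewrite ⟦firstNonZero⟧ (call₁ primeₜ (x₁ ⊕ x₀)) k (s ∷ []) =
      outcome (m≤n⇒m<n∨m≡n (firstNonZero-≤ R k))
      where
      R : ℕ → ℕ
      R t = ⟦ primeₜ ⟧ (s + t ∷ [])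
      ¬prime-below : ∀ t → t < firstNonZero R k → ¬ Prime (s + t)
      ¬prime-below t t<μ p = 1+n≢0 (trans (sym (primeₜ-prime _ p)) (firstNonZero-below R k t t<μ))
      prime-at : firstNonZero R k < k → Prime (s + firstNonZero R k)
      prime-at μ<k with prime? (s + firstNonZero R k)
      ... | yes p = p
      ... | no ¬p = ⊥-elim (firstNonZero-hit R k μ<k (primeₜ-¬prime _ ¬p))
      outcome : firstNonZero R k < k ⊎ firstNonZero R k ≡ k → s + firstNonZero R k ≡ search k s
      outcome (inj₁ μ<k) = sym (search-first k s _ μ<k (prime-at μ<k) ¬prime-below)
      outcome (inj₂ μ≡k) = trans (cong (s +_) μ≡k)
        (sym (search-none k s (λ t t<k → ¬prime-below t (subst (t <_) (sym μ≡k) t<k))))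

    powₜ : Term 3
    powₜ = rec (lit 1) (x₂ ⊗ x₁) (inc x₂)

    ⟦pow⟧ : ∀ e x B → ⟦ powₜ ⟧ (e ∷ x ∷ B ∷ []) ≡ x ^ e ⊓ suc B
    ⟦pow⟧ zero x B = refl
    ⟦pow⟧ (suc e) x B =
      trans (cong (λ w → (x * w) ⊓ suc B) (⟦pow⟧ e x B)) ([x*[a⊓c]]⊓c≡[x*a]⊓c x (x ^ e) (suc B))

    factₜ : Term 2
    factₜ = rec (lit 1) (inc x₀ ⊗ x₁) x₁

    ⟦fact⟧ : ∀ x B → ⟦ factₜ ⟧ (x ∷ B ∷ []) ≡ x ! ⊓ B
    ⟦fact⟧ zero B = refl
    ⟦fact⟧ (suc x) B =
      trans (cong (λ w → (suc x * w) ⊓ B) (⟦fact⟧ x B)) ([x*[a⊓c]]⊓c≡[x*a]⊓c (suc x) (x !) B)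

    -- The step of a sequence truncated at 1 + B: once the previous value has passed B
    -- the next one is 1 + B again.
    truncStepₜ : Term 3 → Term 3
    truncStepₜ next = ifZeroₜ (call₂ leₜ x₁ x₂) (inc x₂) next

    ⟦truncStep⟧ : ∀ (next : Term 3) {u : ℕ → ℕ} → (∀ j → u j < u (suc j)) →
                  (∀ j B → u j ≤ B → ⟦ next ⟧ (j ∷ u j ∷ B ∷ []) ⊓ suc B ≡ u (suc j) ⊓ suc B) →
                  ∀ j B → ⟦ truncStepₜ next ⟧ (j ∷ u j ⊓ suc B ∷ B ∷ []) ⊓ suc B ≡ u (suc j) ⊓ suc B
    ⟦truncStep⟧ next {u} u-< step j B
      rewrite ⟦ifZero⟧ (call₂ leₜ x₁ x₂) (inc x₂) next (j ∷ u j ⊓ suc B ∷ B ∷ []) with u j ≤? B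
    ... | yes uj≤B rewrite m≤n⇒m⊓n≡m (≤-trans uj≤B (n≤1+n B)) | leₜ-≤ (u j) B uj≤B
                         | ifZero-suc 0 (suc B) (⟦ next ⟧ (j ∷ u j ∷ B ∷ [])) =
      step j B uj≤B
    ... | no uj≰B rewrite m≥n⇒m⊓n≡n (≰⇒> uj≰B) | leₜ-> (suc B) B ≤-refl
                        | ifZero-zero (suc B) (⟦ next ⟧ (j ∷ suc B ∷ B ∷ [])) =
      trans (⊓-idem (suc B)) (sym (m≥n⇒m⊓n≡n (≤-trans (≰⇒> uj≰B) (<⇒≤ (u-< j)))))

    nextPrimeₜ : Term 3
    nextPrimeₜ = call₂ searchₜ (call₂ factₜ x₁ x₂) (inc x₁)

    Pₜ : Term 2
    Pₜ = rec (lit 2) (truncStepₜ nextPrimeₜ) (inc x₁)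

    ⟦P⟧ : ∀ j B → ⟦ Pₜ ⟧ (j ∷ B ∷ []) ≡ P j ⊓ suc B
    ⟦P⟧ zero B = refl
    ⟦P⟧ (suc j) B rewrite ⟦P⟧ j B = ⟦truncStep⟧ nextPrimeₜ P-< step j B
      where
      step : ∀ j B → P j ≤ B →
             ⟦ searchₜ ⟧ (⟦ factₜ ⟧ (P j ∷ B ∷ []) ∷ suc (P j) ∷ []) ⊓ suc B ≡ P (suc j) ⊓ suc B
      step j B _ = trans (cong (_⊓ suc B) (trans (⟦search⟧ (⟦ factₜ ⟧ (P j ∷ B ∷ [])) (suc (P j)))
                                                 (cong (λ k → search k (suc (P j))) (⟦fact⟧ (P j) B))))
                         (search[k⊓b]⊓1+b≡search[k]⊓1+b (P j !) B (suc (P j)) (s≤s z≤n))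

    gExponentₜ : Term 3
    gExponentₜ = lit 2 ⊗ (x₀ ⊕ lit 2) ⊗ ((x₁ ⊕ lit 1) ⊗ ((x₁ ⊕ lit 1) ⊗ ((x₁ ⊕ lit 1) ⊗ lit 1)))

    next-gₜ : Term 3
    next-gₜ = call₃ powₜ gExponentₜ (call₂ Pₜ x₀ x₂) x₂

    gₜ : Term 2
    gₜ = rec (lit 1) (truncStepₜ next-gₜ) (inc x₁)

    ⟦g⟧ : ∀ j B → ⟦ gₜ ⟧ (j ∷ B ∷ []) ≡ g j ⊓ suc B
    ⟦g⟧ zero B = refl
    ⟦g⟧ (suc j) B rewrite ⟦g⟧ j B = ⟦truncStep⟧ next-gₜ g-< step j B
      where
      step : ∀ j B → g j ≤ B →
             ⟦ powₜ ⟧ (gExponent j ∷ ⟦ Pₜ ⟧ (j ∷ B ∷ []) ∷ B ∷ []) ⊓ suc B ≡ g (suc j) ⊓ suc B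
      step j B _ = trans (cong (_⊓ suc B) (trans (⟦pow⟧ (gExponent j) (⟦ Pₜ ⟧ (j ∷ B ∷ [])) B)
                                                 (cong (λ p → p ^ gExponent j ⊓ suc B) (⟦P⟧ j B))))
        (trans (⊓-assoc ((P j ⊓ suc B) ^ gExponent j) (suc B) (suc B))
              (trans (cong ((P j ⊓ suc B) ^ gExponent j ⊓_) (⊓-idem (suc B)))
                     ([x⊓c]^e⊓c≡x^e⊓c (P j) (gExponent j) (suc B) (≤-trans (s≤s z≤n) (g<gExponent j)))))

    triangleₜ : Term 1
    triangleₜ = rec (lit 0) (x₁ ⊕ inc x₀) (x₀ ⊗ x₀)

    ⟦triangle⟧ : ∀ s → ⟦ triangleₜ ⟧ (s ∷ []) ≡ triangle s
    ⟦triangle⟧ = ⟦rec⟧≡ (lit 0) (x₁ ⊕ inc x₀) (x₀ ⊗ x₀) [] triangle refl (λ _ → refl) triangle≤n*n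

    divₜ : Term 2
    divₜ = app (firstNonZeroₜ (call₂ leₜ (inc x₁) (inc x₀ ⊗ x₂))) (args₃ (inc x₀) x₀ x₁)

    -- Opaque, and used in later terms through prim: unfolding this evaluation inside larger
    -- expressions makes type checking explode.
    opaque
      quot : ℕ → ℕ → ℕ
      quot X Y = ⟦ divₜ ⟧ (X ∷ Y ∷ [])

      ⟦div⟧≡quot : ∀ X Y → ⟦ divₜ ⟧ (X ∷ Y ∷ []) ≡ quot X Y
      ⟦div⟧≡quot X Y = refl

    elem-quot : Elem 2 (λ v → quot (arg₀ v) (arg₁ v))
    elem-quot = ext (elem-⟦⟧ divₜ) (λ { (X ∷ Y ∷ []) → ⟦div⟧≡quot X Y })

    private
      exceeds : ℕ → ℕ → ℕ → ℕ
      exceeds X Y t = ⟦ leₜ ⟧ (suc X ∷ suc t * Y ∷ [])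

      quot≡firstNonZero : ∀ X Y → quot X Y ≡ firstNonZero (exceeds X Y) (suc X)
      quot≡firstNonZero X Y = trans (sym (⟦div⟧≡quot X Y))
        (⟦firstNonZero⟧ (call₂ leₜ (inc x₁) (inc x₀ ⊗ x₂)) (suc X) (X ∷ Y ∷ []))

    quot-≡ : ∀ X Y t → 1 ≤ Y → t * Y ≤ X → X < suc t * Y → quot X Y ≡ t
    quot-≡ X Y t 1≤Y t*Y≤X X<[1+t]*Y = trans (quot≡firstNonZero X Y)
      (firstNonZero-≡ (exceeds X Y) (suc X) t (s≤s (≤-trans (m≤m*n t Y {{>-nonZero 1≤Y}}) t*Y≤X))
        (λ R0 → 1+n≢0 (trans (sym (leₜ-≤ (suc X) (suc t * Y) X<[1+t]*Y)) R0))
        (λ s s<t → leₜ-> (suc X) (suc s * Y) (s≤s (≤-trans (*-monoˡ-≤ Y s<t) t*Y≤X))))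

    quot-bounds : ∀ X Y → 1 ≤ Y → quot X Y * Y ≤ X × X < suc (quot X Y) * Y
    quot-bounds X Y 1≤Y rewrite quot≡firstNonZero X Y = below m (firstNonZero-below R (suc X)) , above
      where
      R = exceeds X Y
      m = firstNonZero R (suc X)
      m<1+X : m < suc X
      m<1+X = firstNonZero-< R (suc X) X ≤-refl
                (λ R0 → 1+n≢0 (trans (sym (leₜ-≤ (suc X) (suc X * Y) (m≤m*n (suc X) Y {{>-nonZero 1≤Y}}))) R0))
      below : ∀ t → (∀ s → s < t → R s ≡ 0) → t * Y ≤ X
      below zero _ = z≤n
      below (suc t) zeros with suc X ≤? suc t * Y
      ... | no X≮ = ≤-pred (≰⇒> X≮)
      ... | yes X< = ⊥-elim (1+n≢0 (trans (sym (leₜ-≤ (suc X) (suc t * Y) X<)) (zeros t ≤-refl)))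
      above : X < suc m * Y
      above with suc X ≤? suc m * Y
      ... | yes X< = X<
      ... | no X≮ = ⊥-elim (firstNonZero-hit R (suc X) m<1+X (leₜ-> (suc X) (suc m * Y) (≰⇒> X≮)))

    quot-even : ∀ t → quot (2 * t) 2 ≡ t
    quot-even t = quot-≡ (2 * t) 2 t (s≤s z≤n) (≤-reflexive (*-comm t 2))
                         (≤-trans (n≤1+n _) (≤-reflexive (cong (λ w → suc (suc w)) (*-comm 2 t))))

    quot-odd : ∀ t → quot (suc (2 * t)) 2 ≡ t
    quot-odd t = quot-≡ (suc (2 * t)) 2 t (s≤s z≤n) (≤-trans (≤-reflexive (*-comm t 2)) (n≤1+n _))
                        (≤-reflexive (cong (λ w → suc (suc w)) (*-comm 2 t)))

    -- The Cantor pairing is inverted through the diagonal index x + y, the least s with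
    -- cantor x y < triangle (1 + s).
    diagonalₜ : Term 1
    diagonalₜ = app (firstNonZeroₜ (call₂ leₜ (inc x₁) (call₁ triangleₜ (inc x₀)))) (args₂ (inc x₀) x₀)

    unpair₂ₜ : Term 1
    unpair₂ₜ = x₀ ⊖ call₁ triangleₜ diagonalₜ

    unpair₁ₜ : Term 1
    unpair₁ₜ = diagonalₜ ⊖ unpair₂ₜ

    ⟦diagonal⟧ : ∀ x y → ⟦ diagonalₜ ⟧ (cantor x y ∷ []) ≡ x + y
    ⟦diagonal⟧ x y =
      trans (⟦firstNonZero⟧ (call₂ leₜ (inc x₁) (call₁ triangleₜ (inc x₀))) (suc c) (c ∷ []))
            (firstNonZero-≡ R (suc c) (x + y) (s≤s (≤-trans (n≤triangle (x + y)) triangle≤c))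
               (λ R0 → 1+n≢0 (trans (sym (leₜ-≤ (suc c) _ c<triangle)) R0))
               (λ s s<x+y → leₜ-> (suc c) _ (s≤s (≤-trans (≤-reflexive (⟦triangle⟧ (suc s)))
                                                           (≤-trans (triangle-mono-≤ s<x+y) triangle≤c)))))
      where
      c = cantor x y
      R : ℕ → ℕ
      R t = ⟦ leₜ ⟧ (suc c ∷ ⟦ triangleₜ ⟧ (suc t ∷ []) ∷ [])
      triangle≤c : triangle (x + y) ≤ c
      triangle≤c = ≤-trans (m≤m+n (triangle (x + y)) y) (≤-reflexive (sym (cantor≡triangle+y x y)))
      c<triangle : suc c ≤ ⟦ triangleₜ ⟧ (suc (x + y) ∷ [])
      c<triangle = begin
        suc c                          ≡⟨ cong suc (cantor≡triangle+y x y) ⟩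
        suc (triangle (x + y) + y)     ≡⟨ sym (+-suc (triangle (x + y)) y) ⟩
        triangle (x + y) + suc y       ≤⟨ +-monoʳ-≤ (triangle (x + y)) (s≤s (m≤n+m y x)) ⟩
        triangle (x + y) + suc (x + y) ≡⟨ sym (⟦triangle⟧ (suc (x + y))) ⟩
        ⟦ triangleₜ ⟧ (suc (x + y) ∷ []) ∎
        where open ≤-Reasoning

    -- Opaque for the same reason as quot.
    opaque
      unpair₁ unpair₂ : ℕ → ℕ
      unpair₁ c = ⟦ unpair₁ₜ ⟧ (c ∷ [])
      unpair₂ c = ⟦ unpair₂ₜ ⟧ (c ∷ [])

      unpair₂-cantor : ∀ x y → unpair₂ (cantor x y) ≡ y
      unpair₂-cantor x y rewrite ⟦diagonal⟧ x y | ⟦triangle⟧ (x + y) | cantor≡triangle+y x y =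
        m+n∸m≡n (triangle (x + y)) y

      unpair₁-cantor : ∀ x y → unpair₁ (cantor x y) ≡ x
      unpair₁-cantor x y = trans (cong₂ _∸_ (⟦diagonal⟧ x y) (unpair₂-cantor x y)) (m+n∸n≡m x y)

      elem-unpair₁ : ElemFun unpair₁
      elem-unpair₁ = ext (elem-⟦⟧ unpair₁ₜ) (λ { (c ∷ []) → refl })

      elem-unpair₂ : ElemFun unpair₂
      elem-unpair₂ = ext (elem-⟦⟧ unpair₂ₜ) (λ { (c ∷ []) → refl })

    elem-cantor : Elem 2 (λ v → cantor (arg₀ v) (arg₁ v))
    elem-cantor = ext (elem-⟦⟧ (call₁ triangleₜ (x₀ ⊕ x₁) ⊕ x₁))
      (λ { (x ∷ y ∷ []) → trans (cong (_+ y) (⟦triangle⟧ (x + y))) (sym (cantor≡triangle+y x y)) })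

  -- frac a D denotes a / D; the denominator D ∸ 1 makes D = 0 behave as D = 1, so the lemmas
  -- below assume 1 ≤ D.
  frac : ℕ → ℕ → ℚᵘ
  frac a D = mkℚᵘ (ℤ.+ a) (D ∸ 1)

  frac-≤ : ∀ a₁ D₁ a₂ D₂ → 1 ≤ D₁ → 1 ≤ D₂ → a₁ * D₂ ≤ a₂ * D₁ → frac a₁ D₁ U.≤ frac a₂ D₂
  frac-≤ a₁ (suc d₁) a₂ (suc d₂) _ _ le =
    *≤* (subst₂ ℤ._≤_ (ℤP.pos-* a₁ (suc d₂)) (ℤP.pos-* a₂ (suc d₁)) (ℤ.+≤+ le))

  frac-< : ∀ a₁ D₁ a₂ D₂ → 1 ≤ D₁ → 1 ≤ D₂ → a₁ * D₂ < a₂ * D₁ → frac a₁ D₁ U.< frac a₂ D₂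
  frac-< a₁ (suc d₁) a₂ (suc d₂) _ _ lt =
    *<* (subst₂ ℤ._<_ (ℤP.pos-* a₁ (suc d₂)) (ℤP.pos-* a₂ (suc d₁)) (ℤ.+<+ lt))

  frac-+ : ∀ a₁ D₁ a₂ D₂ → 1 ≤ D₁ → 1 ≤ D₂ →
           frac a₁ D₁ U.+ frac a₂ D₂ ≡ frac (a₁ * D₂ + a₂ * D₁) (D₁ * D₂)
  frac-+ a₁ (suc d₁) a₂ (suc d₂) _ _ =
    cong (λ n → mkℚᵘ n (d₂ + d₁ * suc d₂))
         (sym (trans (ℤP.pos-+ (a₁ * suc d₂) (a₂ * suc d₁))
                     (cong₂ ℤ._+_ (ℤP.pos-* a₁ (suc d₂)) (ℤP.pos-* a₂ (suc d₁)))))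

  frac-nonNegative : ∀ a D → 1 ≤ D → frac 0 1 U.≤ frac a D
  frac-nonNegative a D 1≤D = frac-≤ 0 1 a D ≤-refl 1≤D z≤n

  negative<frac : ∀ n d a D → 1 ≤ D → mkℚᵘ ℤ.-[1+ n ] d U.< frac a D
  negative<frac n d a D 1≤D = UP.<-≤-trans (UP.negative⁻¹ (mkℚᵘ ℤ.-[1+ n ] d)) (frac-nonNegative a D 1≤D)

  1/n≃frac1n : ∀ n .{{_ : NonZero n}} → ℚ.toℚᵘ ((ℤ.+ 1) ℚ./ n) ≃ frac 1 n
  1/n≃frac1n (suc m) = ℚP.toℚᵘ-fromℚᵘ (mkℚᵘ (ℤ.+ 1) m)

  p≤p+q : ∀ p q → frac 0 1 U.≤ q → p U.≤ p U.+ q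
  p≤p+q p q 0≤q = UP.≤-trans (UP.≤-reflexive-≡ (sym (UP.+-identityʳ-≡ p))) (UP.+-monoʳ-≤ p 0≤q)

  antitone-≤ : (Q : ℕ → ℚᵘ) → (∀ k → Q (suc k) U.≤ Q k) → ∀ {n k} → n ≤ k → Q k U.≤ Q n
  antitone-≤ Q step {k = zero} z≤n = UP.≤-refl
  antitone-≤ Q step {n} {suc k} n≤1+k with m≤n⇒m<n∨m≡n n≤1+k
  ... | inj₂ refl = UP.≤-refl
  ... | inj₁ n<1+k = UP.≤-trans (step k) (antitone-≤ Q step (≤-pred n<1+k))

  monotone-≤ : (Q : ℕ → ℚᵘ) → (∀ k → Q k U.≤ Q (suc k)) → ∀ {n k} → n ≤ k → Q n U.≤ Q k
  monotone-≤ Q step {k = zero} z≤n = UP.≤-refl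
  monotone-≤ Q step {n} {suc k} n≤1+k with m≤n⇒m<n∨m≡n n≤1+k
  ... | inj₂ refl = UP.≤-refl
  ... | inj₁ n<1+k = UP.≤-trans (monotone-≤ Q step (≤-pred n<1+k)) (step k)

  2∤1+2t : ∀ t → ¬ (2 ∣ suc (2 * t))
  2∤1+2t t (divides q e) = 1+n≢0 (trans (sym odd) even)
    where
    odd : suc (2 * t) % 2 ≡ 1
    odd = trans (cong (λ w → suc w % 2) (*-comm 2 t)) ([m+kn]%n≡m%n 1 t 2)
    even : suc (2 * t) % 2 ≡ 0
    even = trans (cong (_% 2) e) (m*n%n≡0 q 2)

  odd-coprime-2 : ∀ t → Coprime (suc (2 * t)) 2
  odd-coprime-2 t {zero} (_ , 0∣2) with () ← 0∣⇒≡0 0∣2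
  odd-coprime-2 t {1} _ = refl
  odd-coprime-2 t {2} (2∣odd , _) = ⊥-elim (2∤1+2t t 2∣odd)
  odd-coprime-2 t {suc (suc (suc e))} (_ , e∣2) with s≤s (s≤s ()) ← ∣⇒≤ e∣2

  odd-coprime-2^ : ∀ t k → Coprime (suc (2 * t)) (2 ^ k)
  odd-coprime-2^ t zero (_ , d∣1) = ∣1⇒≡1 d∣1
  odd-coprime-2^ t (suc k) {d} (d∣odd , d∣2^[1+k]) = odd-coprime-2^ t k (d∣odd , coprime-divisor d⊥2 d∣2^[1+k])
    where
    d⊥2 : Coprime d 2
    d⊥2 (e∣d , e∣2) = odd-coprime-2 t (∣-trans e∣d d∣odd , e∣2)

  -- The three comparisons behind the choice of T q = m / K (m odd, K = 2 ^ (4bD)) for q = N / b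
  -- lying above A / D, stated with denominators cleared.
  A/D+1/4bD<N/b : ∀ A N b D → 1 ≤ b → 1 ≤ D → A * b < N * D →
                  (A * (4 * b * D) + 1 * D) * b < N * (D * (4 * b * D))
  A/D+1/4bD<N/b A N b D 1≤b 1≤D A*b<N*D = begin-strict
    (A * (4 * b * D) + 1 * D) * b   ≡⟨ expand₁ A b D ⟩
    A * b * (4 * b * D) + D * b     <⟨ +-monoʳ-< (A * b * (4 * b * D)) D*b<4bD ⟩
    A * b * (4 * b * D) + 4 * b * D ≡⟨ sym (expand₂ A b D) ⟩
    (A * b + 1) * (4 * b * D)       ≤⟨ *-monoˡ-≤ (4 * b * D) (≤-trans (≤-reflexive (+-comm (A * b) 1)) A*b<N*D) ⟩
    N * D * (4 * b * D)             ≡⟨ *-assoc N D (4 * b * D) ⟩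
    N * (D * (4 * b * D))           ∎
    where
    open ≤-Reasoning
    expand₁ : ∀ A b D → (A * (4 * b * D) + 1 * D) * b ≡ A * b * (4 * b * D) + D * b
    expand₁ = solve-∀
    expand₂ : ∀ A b D → (A * b + 1) * (4 * b * D) ≡ A * b * (4 * b * D) + 4 * b * D
    expand₂ = solve-∀
    D*b<4bD : D * b < 4 * b * D
    D*b<4bD = begin-strict
      D * b             <⟨ m<m+n (D * b) (≤-trans (*-mono-≤ 1≤D 1≤b) (m≤n*m (D * b) 3)) ⟩
      D * b + 3 * (D * b) ≡⟨ expand₃ b D ⟩
      4 * b * D         ∎
      where
      expand₃ : ∀ b D → D * b + 3 * (D * b) ≡ 4 * b * D
      expand₃ = solve-∀

  A/D+1/4bD<o/K : ∀ A b D K m o → 1 ≤ D → K * (2 * b * A + 1) < suc m * (2 * b * D) → suc m ≤ o →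
                  (A * (4 * b * D) + 1 * D) * K < o * (D * (4 * b * D))
  A/D+1/4bD<o/K A b D K m o 1≤D K[2bA+1]<[1+m]2bD 1+m≤o = begin-strict
    (A * (4 * b * D) + 1 * D) * K          ≤⟨ m≤m+n _ (D * K) ⟩
    (A * (4 * b * D) + 1 * D) * K + D * K  ≡⟨ sym (expand₁ K A b D) ⟩
    K * (2 * b * A + 1) * (2 * D)          <⟨ *-monoˡ-< (2 * D) {{2D≢0}} K[2bA+1]<[1+m]2bD ⟩
    suc m * (2 * b * D) * (2 * D)          ≤⟨ *-monoˡ-≤ (2 * D) (*-monoˡ-≤ (2 * b * D) 1+m≤o) ⟩
    o * (2 * b * D) * (2 * D)              ≡⟨ expand₂ o b D ⟩
    o * (D * (4 * b * D))                  ∎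
    where
    open ≤-Reasoning
    2D≢0 : NonZero (2 * D)
    2D≢0 = >-nonZero (≤-trans 1≤D (m≤n*m D 2))
    expand₁ : ∀ K A b D → K * (2 * b * A + 1) * (2 * D) ≡ (A * (4 * b * D) + 1 * D) * K + D * K
    expand₁ = solve-∀
    expand₂ : ∀ o b D → o * (2 * b * D) * (2 * D) ≡ o * (D * (4 * b * D))
    expand₂ = solve-∀

  o/K<N/b : ∀ A N b D K m o → A * b < N * D → m * (2 * b * D) ≤ K * (2 * b * A + 1) →
            o ≤ m + 2 → 4 * b * D < K → o * b < N * K
  o/K<N/b A N b D K m o A*b<N*D m2bD≤K[2bA+1] o≤m+2 4bD<K = *-cancelʳ-< (2 * D) (o * b) (N * K) (begin-strict
    o * b * (2 * D)                        ≡⟨ expand₁ o b D ⟩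
    o * (2 * b * D)                        ≤⟨ *-monoˡ-≤ (2 * b * D) o≤m+2 ⟩
    (m + 2) * (2 * b * D)                  ≡⟨ *-distribʳ-+ (2 * b * D) m 2 ⟩
    m * (2 * b * D) + 2 * (2 * b * D)      ≤⟨ +-monoˡ-≤ (2 * (2 * b * D)) m2bD≤K[2bA+1] ⟩
    K * (2 * b * A + 1) + 2 * (2 * b * D)  <⟨ +-monoʳ-< (K * (2 * b * A + 1))
                                                  (<-≤-trans (≤-reflexive (cong suc (expand₂ b D))) 4bD<K) ⟩
    K * (2 * b * A + 1) + K                ≡⟨ sym (expand₃ K A b) ⟩
    K * (2 * (A * b + 1))                  ≤⟨ *-monoʳ-≤ K (*-monoʳ-≤ 2
                                                  (≤-trans (≤-reflexive (+-comm (A * b) 1)) A*b<N*D)) ⟩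
    K * (2 * (N * D))                      ≡⟨ sym (expand₄ N K D) ⟩
    N * K * (2 * D)                        ∎)
    where
    open ≤-Reasoning
    expand₁ : ∀ o b D → o * b * (2 * D) ≡ o * (2 * b * D)
    expand₁ = solve-∀
    expand₂ : ∀ b D → 2 * (2 * b * D) ≡ 4 * b * D
    expand₂ = solve-∀
    expand₃ : ∀ K A b → K * (2 * (A * b + 1)) ≡ K * (2 * b * A + 1) + K
    expand₃ = solve-∀
    expand₄ : ∀ N K D → N * K * (2 * D) ≡ K * (2 * (N * D))
    expand₄ = solve-∀

  module Approximation (f : ℕ → ℕ) (elem-graph : Elem 2 (λ v → graphχ f (arg₀ v) (arg₁ v)))
                       (f-step : ∀ x → f x ≤ f (suc x)) where

    open Terms (graphχ f) elem-graph

    fₜ : Term 2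
    fₜ = app (firstNonZeroₜ (graph x₁ x₀)) (args₂ (inc x₁) x₀)

    ⟦f⟧ : ∀ i B → ⟦ fₜ ⟧ (i ∷ B ∷ []) ≡ f i ⊓ suc B
    ⟦f⟧ i B with f i ≤? B
    ... | yes fi≤B = trans (⟦firstNonZero⟧ (graph x₁ x₀) (suc B) (i ∷ []))
      (trans (firstNonZero-≡ (graphχ f i) (suc B) (f i) (s≤s fi≤B)
                (λ R0 → 1+n≢0 (trans (sym (graphχ-≡ f i)) R0))
                (λ y y<fi → graphχ-≢ f i y (λ e → <-irrefl (sym e) y<fi)))
             (sym (m≤n⇒m⊓n≡m (≤-trans fi≤B (n≤1+n B)))))
    ... | no fi≰B = trans (⟦firstNonZero⟧ (graph x₁ x₀) (suc B) (i ∷ []))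
      (trans (firstNonZero-none (graphχ f i) (suc B)
                (λ y y<1+B → graphχ-≢ f i y (λ e → <-irrefl (sym e) (<-≤-trans y<1+B (≰⇒> fi≰B)))))
             (sym (m≥n⇒m⊓n≡n (≰⇒> fi≰B))))

    hₜ : Term 2
    hₜ = call₂ gₜ (call₂ fₜ x₀ x₁ ⊕ x₀) x₁

    ⟦h⟧ : ∀ i B → ⟦ hₜ ⟧ (i ∷ B ∷ []) ≡ h f i ⊓ suc B
    ⟦h⟧ i B = trans (⟦g⟧ (⟦ fₜ ⟧ (i ∷ B ∷ []) + i) B)
                    (trans (cong (λ m → g (m + i) ⊓ suc B) (⟦f⟧ i B)) (g[m⊓c+i]⊓c≡g[m+i]⊓c (f i) i (suc B)))

    E : ℕ → ℕ
    E i = P i ^ h f i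

    Eₜ : Term 2
    Eₜ = call₃ powₜ hₜ (call₂ Pₜ x₀ x₁) x₁

    ⟦E⟧ : ∀ i B → ⟦ Eₜ ⟧ (i ∷ B ∷ []) ≡ E i ⊓ suc B
    ⟦E⟧ i B = begin
      ⟦ powₜ ⟧ (⟦ hₜ ⟧ (i ∷ B ∷ []) ∷ ⟦ Pₜ ⟧ (i ∷ B ∷ []) ∷ B ∷ [])
        ≡⟨ ⟦pow⟧ (⟦ hₜ ⟧ (i ∷ B ∷ [])) (⟦ Pₜ ⟧ (i ∷ B ∷ [])) B ⟩
      ⟦ Pₜ ⟧ (i ∷ B ∷ []) ^ ⟦ hₜ ⟧ (i ∷ B ∷ []) ⊓ suc B
        ≡⟨ cong₂ (λ p e → p ^ e ⊓ suc B) (⟦P⟧ i B) (⟦h⟧ i B) ⟩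
      (P i ⊓ suc B) ^ (h f i ⊓ suc B) ⊓ suc B
        ≡⟨ [x⊓c]^e⊓c≡x^e⊓c (P i) (h f i ⊓ suc B) (suc B) (⊓-pres-m< (g≥1 (f i + i)) (s≤s z≤n)) ⟩
      P i ^ (h f i ⊓ suc B) ⊓ suc B
        ≡⟨ x^[e⊓c]⊓c≡x^e⊓c (P i) (h f i) (suc B) (P≥2 i) ⟩
      E i ⊓ suc B ∎
      where open ≡-Reasoning

    f-mono-≤ : ∀ {i j} → i ≤ j → f i ≤ f j
    f-mono-≤ = ≤-step-mono f f-step

    E≥1 : ∀ i → 1 ≤ E i
    E≥1 i = m^n>0 (P i) {{>-nonZero (≤-trans (s≤s z≤n) (P≥2 i))}} (h f i)

    2*E≤E[1+i] : ∀ i → 2 * E i ≤ E (suc i)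
    2*E≤E[1+i] i = begin
      2 * E i           ≤⟨ *-monoˡ-≤ (E i) (P≥2 i) ⟩
      P i ^ suc (h f i) ≤⟨ ^-mono-≤ (≤-trans (s≤s z≤n) (P≥2 i)) (<⇒≤ (P-< i)) h-< ⟩
      E (suc i)         ∎
      where
      open ≤-Reasoning
      h-< : suc (h f i) ≤ h f (suc i)
      h-< = g-mono-< (≤-trans (≤-reflexive (sym (+-suc (f i) i))) (+-monoˡ-≤ (suc i) (f-step i)))

    E-mono-≤ : ∀ {i j} → i ≤ j → E i ≤ E j
    E-mono-≤ = ≤-step-mono E (λ j → ≤-trans (m≤m+n (E j) (E j + 0)) (2*E≤E[1+i] j))

    -- α^f_(n-1) = A n / D n with D n = E 0 ⋯ E (n-1)
    D : ℕ → ℕ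
    D zero = 1
    D (suc n) = D n * E n

    A : ℕ → ℕ
    A zero = 0
    A (suc n) = A n * E n + D n

    D≥1 : ∀ n → 1 ≤ D n
    D≥1 zero = ≤-refl
    D≥1 (suc n) = *-mono-≤ (D≥1 n) (E≥1 n)

    D≤E^n : ∀ n M → n ≤ suc M → D n ≤ E M ^ n
    D≤E^n zero M _ = ≤-refl
    D≤E^n (suc n) M (s≤s n≤M) = begin
      D n * E n      ≤⟨ *-mono-≤ (D≤E^n n M (≤-trans n≤M (n≤1+n M))) (E-mono-≤ n≤M) ⟩
      E M ^ n * E M  ≡⟨ *-comm (E M ^ n) (E M) ⟩
      E M ^ suc n    ∎
      where open ≤-Reasoning

    -- For q with denominator b = 1 + d, an index n with Good d n makes the tail after A n / D n,
    -- at most 2 / E n, smaller than 1 / (4 b D n).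
    gapFactor : ℕ → ℕ
    gapFactor d = 8 * suc d

    Good : ℕ → ℕ → Set
    Good d n = gapFactor d * D n ≤ E n

    -- The exponent of E (2 + d) is g of an argument ≥ 1 + d, which dominates D (2 + d) and the
    -- factor 8 (2 + d) in one step of the recursion for g.
    good-at-2+d : ∀ d → Good d (suc (suc d))
    good-at-2+d d = begin
      gapFactor d * D (suc b)                ≤⟨ *-mono-≤ gapFactor≤ (D≤E^n (suc b) b ≤-refl) ⟩
      Pm ^ (3 + b) * E b ^ suc b            ≤⟨ *-monoʳ-≤ (Pm ^ (3 + b)) (^-monoˡ-≤ (suc b) Eb≤) ⟩
      Pm ^ (3 + b) * (Pm ^ g m) ^ suc b     ≡⟨ cong (Pm ^ (3 + b) *_) (^-*-assoc Pm (g m) (suc b)) ⟩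
      Pm ^ (3 + b) * Pm ^ (g m * suc b)     ≡⟨ sym (^-distribˡ-+-* Pm (3 + b) (g m * suc b)) ⟩
      Pm ^ (3 + b + g m * suc b)            ≤⟨ ^-monoʳ-≤ Pm {{>-nonZero (≤-trans (s≤s z≤n) (P≥2 m))}}
                                                          (3+b+g*[1+b]≤gExponent b≤m) ⟩
      g (suc m)                             <⟨ n<2^n (g (suc m)) ⟩
      2 ^ g (suc m)                         ≤⟨ ^-monoˡ-≤ (g (suc m)) (P≥2 (suc b)) ⟩
      P (suc b) ^ g (suc m)                 ≡⟨ cong (λ w → P (suc b) ^ g w) (sym (+-suc (f (suc b)) b)) ⟩
      E (suc b)                             ∎
      where
      open ≤-Reasoning
      b = suc d
      m = f (suc b) + b
      Pm = P m
      b≤m : b ≤ m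
      b≤m = m≤n+m b (f (suc b))
      gapFactor≤ : gapFactor d ≤ Pm ^ (3 + b)
      gapFactor≤ = ≤-trans (*-monoʳ-≤ 8 (<⇒≤ (n<2^n b)))
                     (≤-trans (≤-reflexive (sym (^-distribˡ-+-* 2 3 b))) (^-monoˡ-≤ (3 + b) (P≥2 m)))
      Eb≤ : E b ≤ Pm ^ g m
      Eb≤ = ^-mono-≤ (≤-trans (s≤s z≤n) (P≥2 b)) (P-mono-≤ b≤m)
                     (g-mono-≤ (+-mono-≤ (f-mono-≤ (n≤1+n b)) ≤-refl))

    -- frozenD d j and frozenA d j run through D and A up to index j, but stop moving at the first
    -- good index.  D moves only when E j < gapFactor d * r, so gapFactor d * frozenD d j at most
    -- squares in each step, which supplies the bound required by bounded recursion.
    nextD : ℕ → ℕ → ℕ → ℕ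
    nextD d j r with gapFactor d * r ≤? E j
    ... | yes _ = r
    ... | no _ = r * E j

    nextA : ℕ → ℕ → ℕ → ℕ → ℕ
    nextA d j a r with gapFactor d * r ≤? E j
    ... | yes _ = a
    ... | no _ = a * E j + r

    frozenD : ℕ → ℕ → ℕ
    frozenD d zero = 1
    frozenD d (suc j) = nextD d j (frozenD d j)

    frozenA : ℕ → ℕ → ℕ
    frozenA d zero = 0
    frozenA d (suc j) = nextA d j (frozenA d j) (frozenD d j)

    module _ (d j r : ℕ) where

      nextD-stop : gapFactor d * r ≤ E j → nextD d j r ≡ r
      nextD-stop good with gapFactor d * r ≤? E j
      ... | yes _ = refl
      ... | no bad = ⊥-elim (bad good)

      nextD-move : gapFactor d * r ≰ E j → nextD d j r ≡ r * E j
      nextD-move bad with gapFactor d * r ≤? E j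
      ... | yes good = ⊥-elim (bad good)
      ... | no _ = refl

      nextA-stop : ∀ a → gapFactor d * r ≤ E j → nextA d j a r ≡ a
      nextA-stop a good with gapFactor d * r ≤? E j
      ... | yes _ = refl
      ... | no bad = ⊥-elim (bad good)

      nextA-move : ∀ a → gapFactor d * r ≰ E j → nextA d j a r ≡ a * E j + r
      nextA-move a bad with gapFactor d * r ≤? E j
      ... | yes good = ⊥-elim (bad good)
      ... | no _ = refl

    FrozenAt : ℕ → ℕ → Set
    FrozenAt d j = Σ ℕ λ n → n ≤ j × frozenD d j ≡ D n × frozenA d j ≡ A n × (n < j → Good d n)

    frozenAt : ∀ d j → FrozenAt d j
    frozenAt d zero = 0 , z≤n , refl , refl , λ ()
    frozenAt d (suc j) with frozenAt d j
    ... | n , n≤j , eD , eA , good = extend (m≤n⇒m<n∨m≡n n≤j) (gapFactor d * frozenD d j ≤? E j)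
      where
      extend : n < j ⊎ n ≡ j → Dec (gapFactor d * frozenD d j ≤ E j) → FrozenAt d (suc j)
      extend (inj₁ n<j) _ =
        n , ≤-trans n≤j (n≤1+n j) , trans (nextD-stop d j _ halt) eD , trans (nextA-stop d j _ _ halt) eA ,
        λ _ → good n<j
        where
        halt : gapFactor d * frozenD d j ≤ E j
        halt = ≤-trans (≤-reflexive (cong (gapFactor d *_) eD)) (≤-trans (good n<j) (E-mono-≤ (<⇒≤ n<j)))
      extend (inj₂ refl) (yes halt) =
        n , n≤1+n n , trans (nextD-stop d n _ halt) eD , trans (nextA-stop d n _ _ halt) eA ,
        λ _ → ≤-trans (≤-reflexive (cong (gapFactor d *_) (sym eD))) halt
      extend (inj₂ refl) (no move) =
        suc n , ≤-refl , trans (nextD-move d n _ move) (cong (_* E n) eD) ,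
        trans (nextA-move d n _ _ move) (cong₂ (λ a r → a * E n + r) eA eD) , λ n<n → ⊥-elim (<-irrefl refl n<n)

    gapFactor*frozenD≤ : ∀ d j → gapFactor d * frozenD d j ≤ 2 ^ (gapFactor d * 2 ^ j)
    gapFactor*frozenD≤ d zero = ≤-trans (≤-reflexive (*-identityʳ (gapFactor d)))
      (≤-trans (<⇒≤ (n<2^n (gapFactor d))) (≤-reflexive (cong (2 ^_) (sym (*-identityʳ (gapFactor d))))))
    gapFactor*frozenD≤ d (suc j) = step (gapFactor d * frozenD d j ≤? E j)
     where
     step : Dec (gapFactor d * frozenD d j ≤ E j) → gapFactor d * frozenD d (suc j) ≤ 2 ^ (gapFactor d * 2 ^ suc j)
     step (yes halt) = ≤-trans (≤-reflexive (cong (gapFactor d *_) (nextD-stop d j _ halt)))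
        (≤-trans (gapFactor*frozenD≤ d j) (^-monoʳ-≤ 2 (*-monoʳ-≤ (gapFactor d) (^-monoʳ-≤ 2 (n≤1+n j)))))
     step (no move) = begin
      gapFactor d * frozenD d (suc j)          ≡⟨ cong (gapFactor d *_) (nextD-move d j _ move) ⟩
      gapFactor d * (frozenD d j * E j)        ≡⟨ sym (*-assoc (gapFactor d) (frozenD d j) (E j)) ⟩
      gapFactor d * frozenD d j * E j          ≤⟨ *-monoʳ-≤ (gapFactor d * frozenD d j) (<⇒≤ (≰⇒> move)) ⟩
      gapFactor d * frozenD d j * (gapFactor d * frozenD d j)
                                               ≤⟨ *-mono-≤ (gapFactor*frozenD≤ d j) (gapFactor*frozenD≤ d j) ⟩
      2 ^ X * 2 ^ X                            ≡⟨ sym (^-distribˡ-+-* 2 X X) ⟩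
      2 ^ (X + X)                              ≡⟨ cong (2 ^_) (sym X+X) ⟩
      2 ^ (gapFactor d * 2 ^ suc j)            ∎
      where
      open ≤-Reasoning
      X = gapFactor d * 2 ^ j
      X+X : gapFactor d * 2 ^ suc j ≡ X + X
      X+X = trans (cong (gapFactor d *_) (cong (2 ^ j +_) (+-identityʳ (2 ^ j))))
                  (*-distribˡ-+ (gapFactor d) (2 ^ j) (2 ^ j))

    frozenD≤ : ∀ d j → frozenD d j ≤ 2 ^ (gapFactor d * 2 ^ j)
    frozenD≤ d j = ≤-trans (m≤n*m (frozenD d j) (gapFactor d)) (gapFactor*frozenD≤ d j)

    frozenA≤ : ∀ d j → frozenA d j ≤ j * frozenD d j
    frozenA≤ d zero = z≤n
    frozenA≤ d (suc j) = step (gapFactor d * frozenD d j ≤? E j)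
     where
     step : Dec (gapFactor d * frozenD d j ≤ E j) → frozenA d (suc j) ≤ suc j * frozenD d (suc j)
     step (yes halt) = begin
      frozenA d (suc j)         ≡⟨ nextA-stop d j _ _ halt ⟩
      frozenA d j               ≤⟨ frozenA≤ d j ⟩
      j * frozenD d j           ≤⟨ *-monoˡ-≤ (frozenD d j) (n≤1+n j) ⟩
      suc j * frozenD d j       ≡⟨ cong (suc j *_) (sym (nextD-stop d j _ halt)) ⟩
      suc j * frozenD d (suc j) ∎
      where open ≤-Reasoning
     step (no move) = begin
      frozenA d (suc j)                                ≡⟨ nextA-move d j _ _ move ⟩
      frozenA d j * E j + frozenD d j                  ≤⟨ +-mono-≤ (*-monoˡ-≤ (E j) (frozenA≤ d j))
                                                                 (m≤m*n (frozenD d j) (E j) {{>-nonZero (E≥1 j)}}) ⟩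
      j * frozenD d j * E j + frozenD d j * E j        ≡⟨ cong (_+ frozenD d j * E j) (*-assoc j (frozenD d j) (E j)) ⟩
      j * (frozenD d j * E j) + frozenD d j * E j      ≡⟨ +-comm (j * (frozenD d j * E j)) (frozenD d j * E j) ⟩
      suc j * (frozenD d j * E j)                      ≡⟨ cong (suc j *_) (sym (nextD-move d j _ move)) ⟩
      suc j * frozenD d (suc j)                        ∎
      where open ≤-Reasoning

    -- The truncation E j ⊓ (1 + gapFactor d * r) suffices to decide Good and to multiply by E j.
    Eₜ-at : ℕ → ℕ → ℕ → ℕ
    Eₜ-at d j r = ⟦ Eₜ ⟧ (j ∷ gapFactor d * r ∷ [])

    stopₜ : ∀ d j r → gapFactor d * r ≤ E j → ⟦ leₜ ⟧ (gapFactor d * r ∷ Eₜ-at d j r ∷ []) ≡ 1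
    stopₜ d j r halt = leₜ-≤ _ _ (≤-trans (⊓-glb halt (n≤1+n _)) (≤-reflexive (sym (⟦E⟧ j (gapFactor d * r)))))

    Eₜ-at-move : ∀ d j r → gapFactor d * r ≰ E j → Eₜ-at d j r ≡ E j
    Eₜ-at-move d j r move = trans (⟦E⟧ j (gapFactor d * r)) (m≤n⇒m⊓n≡m (≤-trans (<⇒≤ (≰⇒> move)) (n≤1+n _)))

    moveₜ : ∀ d j r → gapFactor d * r ≰ E j → ⟦ leₜ ⟧ (gapFactor d * r ∷ Eₜ-at d j r ∷ []) ≡ 0
    moveₜ d j r move = trans (cong (λ w → ⟦ leₜ ⟧ (gapFactor d * r ∷ w ∷ [])) (Eₜ-at-move d j r move))
                             (leₜ-> _ _ (≰⇒> move))

    gapFactorₜ : Term 3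
    gapFactorₜ = lit 8 ⊗ inc x₂

    nextDₜ : Term 3
    nextDₜ = ifZeroₜ (call₂ leₜ (gapFactorₜ ⊗ x₁) (call₂ Eₜ x₀ (gapFactorₜ ⊗ x₁)))
                     (x₁ ⊗ call₂ Eₜ x₀ (gapFactorₜ ⊗ x₁)) x₁

    ⟦nextD⟧ : ∀ j r d → ⟦ nextDₜ ⟧ (j ∷ r ∷ d ∷ []) ≡ nextD d j r
    ⟦nextD⟧ j r d = trans (⟦ifZero⟧ (call₂ leₜ (gapFactorₜ ⊗ x₁) (call₂ Eₜ x₀ (gapFactorₜ ⊗ x₁)))
                                    (x₁ ⊗ call₂ Eₜ x₀ (gapFactorₜ ⊗ x₁)) x₁ (j ∷ r ∷ d ∷ []))
                            (select (gapFactor d * r ≤? E j))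
      where
      select : Dec (gapFactor d * r ≤ E j) →
               ifZero (⟦ leₜ ⟧ (gapFactor d * r ∷ Eₜ-at d j r ∷ [])) (r * Eₜ-at d j r) r ≡ nextD d j r
      select (yes halt) = trans (cong (λ c → ifZero c (r * Eₜ-at d j r) r) (stopₜ d j r halt))
                                (trans (ifZero-suc 0 _ r) (sym (nextD-stop d j r halt)))
      select (no move) = trans (cong (λ c → ifZero c (r * Eₜ-at d j r) r) (moveₜ d j r move))
                               (trans (ifZero-zero _ r) (trans (cong (r *_) (Eₜ-at-move d j r move))
                                                               (sym (nextD-move d j r move))))

    frozenD-boundₜ : Term 2
    frozenD-boundₜ = pow2 ((lit 8 ⊗ inc x₁) ⊗ pow2 x₀)

    frozenDₜ : Term 2
    frozenDₜ = rec (lit 1) nextDₜ frozenD-boundₜ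

    ⟦frozenD⟧ : ∀ j d → ⟦ frozenDₜ ⟧ (j ∷ d ∷ []) ≡ frozenD d j
    ⟦frozenD⟧ j d = ⟦rec⟧≡ (lit 1) nextDₜ frozenD-boundₜ (d ∷ []) (frozenD d) refl
                           (λ y → sym (⟦nextD⟧ y (frozenD d y) d))
                           (frozenD≤ d) j

    nextAₜ : Term 3
    nextAₜ = ifZeroₜ (call₂ leₜ (gapFactorₜ ⊗ Dₜ) (call₂ Eₜ x₀ (gapFactorₜ ⊗ Dₜ)))
                     (x₁ ⊗ call₂ Eₜ x₀ (gapFactorₜ ⊗ Dₜ) ⊕ Dₜ) x₁
      where
      Dₜ : Term 3
      Dₜ = call₂ frozenDₜ x₀ x₂

    ⟦nextA⟧ : ∀ j a d → ⟦ nextAₜ ⟧ (j ∷ a ∷ d ∷ []) ≡ nextA d j a (frozenD d j)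
    ⟦nextA⟧ j a d = trans (⟦ifZero⟧ (call₂ leₜ (gapFactorₜ ⊗ Dₜ) (call₂ Eₜ x₀ (gapFactorₜ ⊗ Dₜ)))
                                    (x₁ ⊗ call₂ Eₜ x₀ (gapFactorₜ ⊗ Dₜ) ⊕ Dₜ) x₁ (j ∷ a ∷ d ∷ []))
                          (trans (cong (λ r → ifZero (⟦ leₜ ⟧ (gapFactor d * r ∷ Eₜ-at d j r ∷ []))
                                                     (a * Eₜ-at d j r + r) a) (⟦frozenD⟧ j d))
                                 (select (gapFactor d * r ≤? E j)))
      where
      Dₜ : Term 3
      Dₜ = call₂ frozenDₜ x₀ x₂
      r = frozenD d j
      select : Dec (gapFactor d * r ≤ E j) →
               ifZero (⟦ leₜ ⟧ (gapFactor d * r ∷ Eₜ-at d j r ∷ [])) (a * Eₜ-at d j r + r) a ≡ nextA d j a r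
      select (yes halt) = trans (cong (λ c → ifZero c (a * Eₜ-at d j r + r) a) (stopₜ d j r halt))
                                (trans (ifZero-suc 0 _ a) (sym (nextA-stop d j r a halt)))
      select (no move) = trans (cong (λ c → ifZero c (a * Eₜ-at d j r + r) a) (moveₜ d j r move))
                               (trans (ifZero-zero _ a) (trans (cong (λ w → a * w + r) (Eₜ-at-move d j r move))
                                                               (sym (nextA-move d j r a move))))

    frozenAₜ : Term 2
    frozenAₜ = rec (lit 0) nextAₜ (x₀ ⊗ frozenD-boundₜ)

    ⟦frozenA⟧ : ∀ j d → ⟦ frozenAₜ ⟧ (j ∷ d ∷ []) ≡ frozenA d j
    ⟦frozenA⟧ j d = ⟦rec⟧≡ (lit 0) nextAₜ (x₀ ⊗ frozenD-boundₜ) (d ∷ []) (frozenA d) refl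
                           (λ y → sym (⟦nextA⟧ y (frozenA d y) d))
                           (λ y → ≤-trans (frozenA≤ d y) (*-monoʳ-≤ y (frozenD≤ d y))) j

    1/E : ℕ → ℚᵘ
    1/E i = frac 1 (E i)

    A/D : ℕ → ℚᵘ
    A/D n = frac (A n) (D n)

    A/D+1/E : ∀ n → A/D n U.+ 1/E n ≡ A/D (suc n)
    A/D+1/E n = trans (frac-+ (A n) (D n) 1 (E n) (D≥1 n) (E≥1 n))
                      (cong (λ w → frac (A n * E n + w) (D n * E n)) (*-identityˡ (D n)))

    αₙ≃A/D : ∀ m → ℚ.toℚᵘ (αₙ f m) ≃ A/D (suc m)
    αₙ≃A/D zero = UP.≃-trans (1/n≃frac1n (E 0) {{P^n-nonZero 0 (h f 0)}})
                             (UP.≃-reflexive (cong (frac 1) (sym (*-identityˡ (E 0)))))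
    αₙ≃A/D (suc m) =
      UP.≃-trans (ℚP.toℚᵘ-homo-+ (αₙ f m) (term f (suc m)))
        (UP.≃-trans (UP.+-cong (αₙ≃A/D m) (1/n≃frac1n (E (suc m)) {{P^n-nonZero (suc m) (h f (suc m))}}))
                    (UP.≃-reflexive (A/D+1/E (suc m))))

    2/E : ℕ → ℚᵘ
    2/E k = 1/E k U.+ 1/E k

    2/E≡ : ∀ k → 2/E k ≡ frac (1 * E k + 1 * E k) (E k * E k)
    2/E≡ k = frac-+ 1 (E k) 1 (E k) (E≥1 k) (E≥1 k)

    E*E≥1 : ∀ k → 1 ≤ E k * E k
    E*E≥1 k = *-mono-≤ (E≥1 k) (E≥1 k)

    2/E-nonNegative : ∀ k → frac 0 1 U.≤ 2/E k
    2/E-nonNegative k = UP.≤-trans (frac-nonNegative _ _ (E*E≥1 k)) (UP.≤-reflexive-≡ (sym (2/E≡ k)))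

    2/E[1+k]≤1/E : ∀ k → 2/E (suc k) U.≤ 1/E k
    2/E[1+k]≤1/E k = UP.≤-trans (UP.≤-reflexive-≡ (2/E≡ (suc k)))
      (frac-≤ _ _ 1 (E k) (E*E≥1 (suc k)) (E≥1 k) (begin
        (1 * E (suc k) + 1 * E (suc k)) * E k ≡⟨ expand (E (suc k)) (E k) ⟩
        E (suc k) * (2 * E k)                ≤⟨ *-monoʳ-≤ (E (suc k)) (2*E≤E[1+i] k) ⟩
        E (suc k) * E (suc k)                ≡⟨ sym (*-identityˡ _) ⟩
        1 * (E (suc k) * E (suc k))          ∎))
      where
      open ≤-Reasoning
      expand : ∀ x y → (1 * x + 1 * x) * y ≡ x * (2 * y)
      expand = solve-∀

    -- Since 1/E decreases at least geometrically, A/D n + 2/E n bounds every later partial sum.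
    A/D+2/E : ℕ → ℚᵘ
    A/D+2/E n = A/D n U.+ 2/E n

    A/D+2/E-antitone : ∀ n → A/D+2/E (suc n) U.≤ A/D+2/E n
    A/D+2/E-antitone n = begin
      A/D (suc n) U.+ 2/E (suc n)         ≡⟨ cong (U._+ 2/E (suc n)) (sym (A/D+1/E n)) ⟩
      (A/D n U.+ 1/E n) U.+ 2/E (suc n)   ≃⟨ UP.+-assoc (A/D n) (1/E n) (2/E (suc n)) ⟩
      A/D n U.+ (1/E n U.+ 2/E (suc n))   ≤⟨ UP.+-monoʳ-≤ (A/D n) (UP.+-monoʳ-≤ (1/E n) (2/E[1+k]≤1/E n)) ⟩
      A/D n U.+ 2/E n                     ∎
      where open UP.≤-Reasoning

    A/D-monotone : ∀ n → A/D n U.≤ A/D (suc n)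
    A/D-monotone n = UP.≤-trans (p≤p+q (A/D n) (1/E n) (frac-nonNegative 1 (E n) (E≥1 n)))
                                (UP.≤-reflexive-≡ (A/D+1/E n))

    A/D≤A/D+2/E : ∀ k n → A/D k U.≤ A/D+2/E n
    A/D≤A/D+2/E k n with ≤-total n k
    ... | inj₁ n≤k = UP.≤-trans (p≤p+q (A/D k) _ (2/E-nonNegative k)) (antitone-≤ A/D+2/E A/D+2/E-antitone n≤k)
    ... | inj₂ k≤n = UP.≤-trans (monotone-≤ A/D A/D-monotone k≤n) (p≤p+q (A/D n) _ (2/E-nonNegative n))

    2/E≤1/4bD : ∀ d n → Good d n → 2/E n U.≤ frac 1 (4 * suc d * D n)
    2/E≤1/4bD d n good = UP.≤-trans (UP.≤-reflexive-≡ (2/E≡ n))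
      (frac-≤ _ _ 1 (4 * suc d * D n) (E*E≥1 n) (*-mono-≤ {1} {4 * suc d} (s≤s z≤n) (D≥1 n)) (begin
        (1 * E n + 1 * E n) * (4 * suc d * D n) ≡⟨ expand (E n) (suc d) (D n) ⟩
        E n * (gapFactor d * D n)               ≤⟨ *-monoʳ-≤ (E n) good ⟩
        E n * E n                               ≡⟨ sym (*-identityˡ _) ⟩
        1 * (E n * E n)                         ∎))
      where
      open ≤-Reasoning
      expand : ∀ x b D → (1 * x + 1 * x) * (4 * b * D) ≡ x * (8 * b * D)
      expand = solve-∀

    upper : ℕ → ℕ → ℚᵘ
    upper d n = A/D n U.+ frac 1 (4 * suc d * D n)

    αₙ≤upper : ∀ d n → Good d n → ∀ m → ℚ.toℚᵘ (αₙ f m) U.≤ upper d n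
    αₙ≤upper d n good m = UP.≤-trans (UP.≤-reflexive (αₙ≃A/D m))
      (UP.≤-trans (A/D≤A/D+2/E (suc m) n) (UP.+-monoʳ-≤ (A/D n) (2/E≤1/4bD d n good)))

    A/D<αₙ : ∀ n → A/D n U.< ℚ.toℚᵘ (αₙ f n)
    A/D<αₙ n = UP.<-respʳ-≃ (UP.≃-sym (αₙ≃A/D n)) (UP.<-respʳ-≃ (UP.≃-reflexive (A/D+1/E n))
      (UP.<-respʳ-≃ (UP.≃-reflexive (sym (frac-+ (A n) (D n) 1 (E n) (D≥1 n) (E≥1 n))))
        (frac-< _ _ _ _ (D≥1 n) (*-mono-≤ (D≥1 n) (E≥1 n)) (begin-strict
          A n * (D n * E n)                  <⟨ m<m+n (A n * (D n * E n)) (*-mono-≤ (D≥1 n) (D≥1 n)) ⟩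
          A n * (D n * E n) + D n * D n      ≡⟨ sym (expand (A n) (E n) (D n)) ⟩
          (A n * E n + 1 * D n) * D n        ∎))))
      where
      open ≤-Reasoning
      expand : ∀ A E D → (A * E + 1 * D) * D ≡ A * (D * E) + D * D
      expand = solve-∀

    -- For q with denominator b = 1 + d, the search for a good index runs up to 2 + d.  Opaque
    -- for the same reason as quot.
    opaque
      Dq Aq : ℕ → ℕ
      Dq d = frozenD d (suc (suc d))
      Aq d = frozenA d (suc (suc d))

      elem-Dq : ElemFun Dq
      elem-Dq = compose₂ elem-frozenD (compose₁ succ (compose₁ succ (proj zero))) (proj zero)
        where
        elem-frozenD : Elem 2 (λ v → frozenD (arg₁ v) (arg₀ v))
        elem-frozenD = ext (elem-⟦⟧ frozenDₜ) (λ { (j ∷ d ∷ []) → ⟦frozenD⟧ j d })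

      elem-Aq : ElemFun Aq
      elem-Aq = compose₂ elem-frozenA (compose₁ succ (compose₁ succ (proj zero))) (proj zero)
        where
        elem-frozenA : Elem 2 (λ v → frozenA (arg₁ v) (arg₀ v))
        elem-frozenA = ext (elem-⟦⟧ frozenAₜ) (λ { (j ∷ d ∷ []) → ⟦frozenA⟧ j d })

      frozenAt-2+d : ∀ d → Σ ℕ λ n → n ≤ suc (suc d) × Dq d ≡ D n × Aq d ≡ A n × (n < suc (suc d) → Good d n)
      frozenAt-2+d d = frozenAt d (suc (suc d))

    good-index : ∀ d → Σ ℕ λ n → Dq d ≡ D n × Aq d ≡ A n × Good d n
    good-index d with frozenAt-2+d d
    ... | n , n≤2+d , eD , eA , good =
      n , eD , eA , good-n (m≤n⇒m<n∨m≡n n≤2+d)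
      where
      good-n : n < suc (suc d) ⊎ n ≡ suc (suc d) → Good d n
      good-n (inj₁ n<2+d) = good n<2+d
      good-n (inj₂ refl) = good-at-2+d d

    Dq≥1 : ∀ d → 1 ≤ Dq d
    Dq≥1 d with good-index d
    ... | n , eD , _ = subst (1 ≤_) (sym eD) (D≥1 n)

    Kq : ℕ → ℕ
    Kq d = 2 ^ (4 * suc d * Dq d)

    Kq≥1 : ∀ d → 1 ≤ Kq d
    Kq≥1 d = m^n>0 2 (4 * suc d * Dq d)

    -- m is ⌊K (2bA + 1) / (2bD)⌋ and o the odd one among m + 1 and m + 2: then o / K lies
    -- strictly between A / D + 1 / (4bD) and A / D + 1 / b.
    Xq Yq mq oq : ℕ → ℕ
    Xq d = Kq d * (2 * suc d * Aq d + 1)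
    Yq d = 2 * suc d * Dq d
    mq d = quot (Xq d) (Yq d)
    oq d = suc (2 * quot (suc (mq d)) 2)

    oq-coprime : ∀ d → Coprime (oq d) (suc (Kq d ∸ 1))
    oq-coprime d = subst (Coprime (oq d)) (sym (m+[n∸m]≡n (Kq≥1 d)))
                         (odd-coprime-2^ (quot (suc (mq d)) 2) (4 * suc d * Dq d))

    T⁺ : ∀ N d → Dec (N * Dq d ≤ Aq d * suc d) → ℚ
    T⁺ N d (yes _) = 0ℚ
    T⁺ N d (no _) = mkℚ (ℤ.+ oq d) (Kq d ∸ 1) (oq-coprime d)

    T : ℚ → ℚ
    T (mkℚ (ℤ.+ N) d _) = T⁺ N d (N * Dq d ≤? Aq d * suc d)
    T (mkℚ ℤ.-[1+ _ ] _ _) = 0ℚ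

    -- Tₜ reads q = N / (1 + d) from its code cantor x d, where x = 2N for N ≥ 0 and x is odd
    -- for q < 0, and outputs the code of T q.
    private
      quotₜ : Term 1 → Term 1 → Term 1
      quotₜ a b = prim elem-quot (args₂ a b)

      Kqₜ oqₜ outputₜ : Term 1 → Term 1
      Kqₜ d = pow2 (lit 4 ⊗ inc d ⊗ prim elem-Dq (λ _ → d))
      oqₜ d = inc (lit 2 ⊗ quotₜ (inc (quotₜ (Kqₜ d ⊗ (lit 2 ⊗ inc d ⊗ prim elem-Aq (λ _ → d) ⊕ lit 1))
                                             (lit 2 ⊗ inc d ⊗ prim elem-Dq (λ _ → d))))
                                 (lit 2))
      outputₜ d = prim elem-cantor (args₂ (lit 2 ⊗ oqₜ d) (Kqₜ d ⊖ lit 1))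

      conditionₜ : Term 1 → Term 1 → Term 1
      conditionₜ x d = (x ⊖ lit 2 ⊗ quotₜ x (lit 2))
                       ⊕ call₂ leₜ (quotₜ x (lit 2) ⊗ prim elem-Dq (λ _ → d)) (prim elem-Aq (λ _ → d) ⊗ inc d)

      xₜ dₜ : Term 1
      xₜ = prim elem-unpair₁ (λ _ → x₀)
      dₜ = prim elem-unpair₂ (λ _ → x₀)

    Tₜ : Term 1
    Tₜ = ifZeroₜ (conditionₜ xₜ dₜ) (outputₜ dₜ) (lit 0)

    T-condition : ℕ → ℕ → ℕ
    T-condition x d = x ∸ 2 * quot x 2 + ⟦ leₜ ⟧ (quot x 2 * Dq d ∷ Aq d * suc d ∷ [])

    ⟦T⟧ : ∀ c → ⟦ Tₜ ⟧ (c ∷ []) ≡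
          ifZero (T-condition (unpair₁ c) (unpair₂ c)) (cantor (2 * oq (unpair₂ c)) (Kq (unpair₂ c) ∸ 1)) 0
    ⟦T⟧ c = ⟦ifZero⟧ (conditionₜ xₜ dₜ) (outputₜ dₜ) (lit 0) (c ∷ [])

    T-tracked : ∀ q → ⟦ Tₜ ⟧ (encℚ q ∷ []) ≡ encℚ (T q)
    T-tracked q = trans (⟦T⟧ (encℚ q)) (tracked q)
      where
      tracked : ∀ q → ifZero (T-condition (unpair₁ (encℚ q)) (unpair₂ (encℚ q)))
                             (cantor (2 * oq (unpair₂ (encℚ q))) (Kq (unpair₂ (encℚ q)) ∸ 1)) 0 ≡ encℚ (T q)
      tracked (mkℚ ℤ.-[1+ n ] d _)
        rewrite unpair₁-cantor (suc (2 * n)) d | unpair₂-cantor (suc (2 * n)) d | quot-odd n | m+n∸n≡m 1 (2 * n) =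
        ifZero-suc _ _ 0
      tracked (mkℚ (ℤ.+ N) d _)
        rewrite unpair₁-cantor (2 * N) d | unpair₂-cantor (2 * N) d | quot-even N | n∸n≡0 (2 * N) =
        decided (N * Dq d ≤? Aq d * suc d)
        where
        decided : (dec : Dec (N * Dq d ≤ Aq d * suc d)) →
                  ifZero (⟦ leₜ ⟧ (N * Dq d ∷ Aq d * suc d ∷ [])) (cantor (2 * oq d) (Kq d ∸ 1)) 0 ≡ encℚ (T⁺ N d dec)
        decided (yes q≤A/D) rewrite leₜ-≤ _ _ q≤A/D = ifZero-suc 0 _ 0
        decided (no q≰A/D) rewrite leₜ-> _ _ (≰⇒> q≰A/D) = ifZero-zero _ 0

    T-elementary : ElemℚFun T
    T-elementary = (λ c → ⟦ Tₜ ⟧ (c ∷ [])) , ext (elem-⟦⟧ Tₜ) (λ { (c ∷ []) → refl }) , T-tracked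

    module _ (d : ℕ) where

      private
        b = suc d
        n = proj₁ (good-index d)
        Dq≡D = proj₁ (proj₂ (good-index d))
        Aq≡A = proj₁ (proj₂ (proj₂ (good-index d)))

      4bDq≥1 : 1 ≤ 4 * b * Dq d
      4bDq≥1 = *-mono-≤ {1} {4 * b} (s≤s z≤n) (Dq≥1 d)

      upper≡ : upper d n ≡ frac (Aq d * (4 * b * Dq d) + 1 * Dq d) (Dq d * (4 * b * Dq d))
      upper≡ rewrite Dq≡D | Aq≡A = frac-+ (A n) (D n) 1 (4 * b * D n) (D≥1 n) (*-mono-≤ {1} {4 * b} (s≤s z≤n) (D≥1 n))

      αₘ≤upper : ∀ m → ℚ.toℚᵘ (αₙ f m) U.≤ upper d n
      αₘ≤upper = αₙ≤upper d n (proj₂ (proj₂ (proj₂ (good-index d))))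

      q≤A/D⇒q<α : ∀ N → N * Dq d ≤ Aq d * b → frac N b U.< ℚ.toℚᵘ (αₙ f n)
      q≤A/D⇒q<α N q≤A/D = UP.≤-<-trans (subst₂ (λ a D → frac N b U.≤ frac a D) Aq≡A Dq≡D
                                                 (frac-≤ N b (Aq d) (Dq d) (s≤s z≤n) (Dq≥1 d) q≤A/D))
                                        (A/D<αₙ n)

      A/D<q⇒upper<q : ∀ N → Aq d * b < N * Dq d → upper d n U.< frac N b
      A/D<q⇒upper<q N A/D<q = UP.<-respˡ-≃ (UP.≃-reflexive (sym upper≡))
        (frac-< _ _ N b (*-mono-≤ (Dq≥1 d) 4bDq≥1) (s≤s z≤n) (A/D+1/4bD<N/b (Aq d) N b (Dq d) (s≤s z≤n) (Dq≥1 d) A/D<q))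

      oq-bounds : suc (mq d) ≤ oq d × oq d ≤ mq d + 2
      oq-bounds with quot-bounds (suc (mq d)) 2 (s≤s z≤n)
      ... | lower , upper′ = ≤-trans (≤-pred upper′) (s≤s (≤-reflexive (*-comm t 2))) ,
                             ≤-trans (s≤s (≤-trans (≤-reflexive (*-comm 2 t)) lower)) (≤-reflexive (+-comm 2 (mq d)))
        where t = quot (suc (mq d)) 2

      upper<o/K : upper d n U.< frac (oq d) (Kq d)
      upper<o/K with quot-bounds (Xq d) (Yq d) (*-mono-≤ {1} {2 * b} (s≤s z≤n) (Dq≥1 d))
      ... | _ , X<[1+m]Y = UP.<-respˡ-≃ (UP.≃-reflexive (sym upper≡))
        (frac-< _ _ (oq d) (Kq d) (*-mono-≤ (Dq≥1 d) 4bDq≥1) (Kq≥1 d)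
                (A/D+1/4bD<o/K (Aq d) b (Dq d) (Kq d) (mq d) (oq d) (Dq≥1 d) X<[1+m]Y (proj₁ oq-bounds)))

      o/K<q : ∀ N → Aq d * b < N * Dq d → frac (oq d) (Kq d) U.< frac N b
      o/K<q N A/D<q with quot-bounds (Xq d) (Yq d) (*-mono-≤ {1} {2 * b} (s≤s z≤n) (Dq≥1 d))
      ... | mY≤X , _ = frac-< (oq d) (Kq d) N b (Kq≥1 d) (s≤s z≤n)
        (o/K<N/b (Aq d) N b (Dq d) (Kq d) (mq d) (oq d) A/D<q mY≤X (proj₂ oq-bounds) (n<2^n (4 * b * Dq d)))

    T-below : ∀ q → q <α[ f ] → T q ≡ 0ℚ
    T-below (mkℚ ℤ.-[1+ _ ] _ _) _ = refl
    T-below (mkℚ (ℤ.+ N) d _) (m , q<αₘ) = below (N * Dq d ≤? Aq d * suc d)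
      where
      below : (dec : Dec (N * Dq d ≤ Aq d * suc d)) → T⁺ N d dec ≡ 0ℚ
      below (yes _) = refl
      below (no q≰A/D) = ⊥-elim (UP.<-irrefl UP.≃-refl
        (UP.<-trans (ℚP.toℚᵘ-mono-< q<αₘ) (UP.≤-<-trans (αₘ≤upper d m) (A/D<q⇒upper<q d N (≰⇒> q≰A/D)))))

    T-above : ∀ q → α[ f ]< q → (T q ℚ.< q) × α[ f ]< T q
    T-above (mkℚ ℤ.-[1+ n ] d _) (r , r<q , αₘ≤r) = ⊥-elim (UP.<-irrefl UP.≃-refl
      (UP.≤-<-trans (ℚP.toℚᵘ-mono-≤ (αₘ≤r 0))
        (UP.<-trans (ℚP.toℚᵘ-mono-< r<q)
          (UP.<-respʳ-≃ (UP.≃-sym (αₙ≃A/D 0)) (negative<frac n d (A 1) (D 1) (D≥1 1))))))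
    T-above (mkℚ (ℤ.+ N) d N⊥b) (r , r<q , αₘ≤r) = above (N * Dq d ≤? Aq d * suc d)
      where
      n = proj₁ (good-index d)
      above : (dec : Dec (N * Dq d ≤ Aq d * suc d)) → (T⁺ N d dec ℚ.< mkℚ (ℤ.+ N) d N⊥b) × α[ f ]< T⁺ N d dec
      above (yes q≤A/D) = ⊥-elim (UP.<-irrefl UP.≃-refl
        (UP.<-≤-trans (q≤A/D⇒q<α d N q≤A/D)
          (UP.≤-trans (ℚP.toℚᵘ-mono-≤ (αₘ≤r n)) (UP.<⇒≤ (ℚP.toℚᵘ-mono-< r<q)))))
      above (no q≰A/D) = ℚP.toℚᵘ-cancel-< (o/K<q d N (≰⇒> q≰A/D)) ,
        ( ℚ.fromℚᵘ (upper d n)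
        , ℚP.toℚᵘ-cancel-< (UP.<-respˡ-≃ (UP.≃-sym (ℚP.toℚᵘ-fromℚᵘ (upper d n))) (upper<o/K d))
        , λ m → ℚP.toℚᵘ-cancel-≤ (UP.≤-respʳ-≃ (UP.≃-sym (ℚP.toℚᵘ-fromℚᵘ (upper d n))) (αₘ≤upper d m)))

open import Data.Nat using (ℕ)
open import Data.Rational using (ℚ; 0ℚ; _<_)
open import Data.Product using (Σ; _×_; _,_)
open import Relation.Binary.PropositionalEquality using (_≡_)

theorem3 : (f : ℕ → ℕ) → Honest f →
    Σ (ℚ → ℚ) λ T → ElemℚFun T
    × (∀ q → q <α[ f ] → T q ≡ 0ℚ)
    × (∀ q → α[ f ]< q → (T q < q) × α[ f ]< T q)
theorem3 f (f-step , _ , elem-graph) = T , T-elementary , T-below , T-above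
  where open Approximation f elem-graph f-step
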